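{- Let $G,H$ be finite abelian groups with decompositions $G=\bigoplus_pG_p$, $H=\bigoplus_pH_p$ into $p$-components, and let $k\ge1$. Then every $\varphi\in\mathrm{Hom}(G,H)$ is of the form $\bigoplus_p\varphi_p$ with $\varphi_p\in\mathrm{Hom}(G_p,H_p)$, and \[\gamma_k(G,H)=\prod_p\gamma_k(G_p,H_p),\qquad 1-\eta_k(G,H)=\prod_p\bigl(1-\eta_k(G_p,H_p)\bigr).\]
   Context: For finite abelian $G,H$ and $\vec x\in G^k$, $\Gamma_{\vec x}:\mathrm{Hom}(G,H)\to H^k$, $\varphi\mapsto(\varphi(x_1),\dots,\varphi(x_k))$, with image $\mathsf{H}_{\vec x}$. $\gamma_k(G,H)=\sum_{\vec x\in G^k}|\ker\Gamma_{\vec x}|$, and $\eta_k(G,H)=|\{\vec x\in G^k:\mathsf{H}_{\vec x}\ne H^k\}|/|G|^k$. The products run over all primes (all but finitely many factors are for trivial groups and equal $1$). -}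

module Defs where

open import Level using (0ℓ)
open import Data.Nat as ℕ using (ℕ; zero; suc; _^_; NonZero)
open import Data.Nat.Properties using (m^n≢0)
open import Data.Nat.Primality using (Prime; prime?)
open import Data.Fin using (Fin; toℕ)
import Data.Fin.Properties as FinP
open import Data.Integer using (+_)
open import Data.Rational as ℚ using (ℚ; 1ℚ)
open import Data.List using (List; []; _∷_; length; map; filter; concatMap; foldr; upTo)
open import Data.Nat.ListAction using (sum)
open import Data.List.Membership.Propositional using (_∈_)
open import Data.List.Membership.Propositional.Properties using (∈-filter⁺)
open import Data.List.Relation.Unary.Unique.Propositional using (Unique)
import Data.List.Relation.Unary.All as LAll
import Data.List.Relation.Unary.Any as LAny
open import Data.Vec as Vec using (Vec; []; _∷_)
import Data.Vec.Relation.Unary.All as VAll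
import Data.Vec.Properties as VecP
open import Data.Product using (∃; _,_)
open import Relation.Nullary using (Dec; yes; no; ¬?)
open import Relation.Unary using (Decidable)
open import Relation.Binary using (DecidableEquality)
open import Relation.Binary.PropositionalEquality using (_≡_)
open import Algebra.Structures using (IsAbelianGroup)

record FinAbGroup : Set₁ where
  infixl 6 _+_
  field
    Carrier        : Set
    _+_            : Carrier → Carrier → Carrier
    0g             : Carrier
    -_             : Carrier → Carrier
    isAbelianGroup : IsAbelianGroup _≡_ _+_ 0g -_
    _≟_            : DecidableEquality Carrier
    elems          : List Carrier
    elems-complete : ∀ x → x ∈ elems
    elems-unique   : Unique elems

  order : ℕ
  order = length elems

  infixr 8 _·_
  _·_ : ℕ → Carrier → Carrier
  zero  · x = 0g
  suc n · x = x + n · x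

open FinAbGroup

IsHom : (G H : FinAbGroup) → (Carrier G → Carrier H) → Set
IsHom G H φ = ∀ a b → φ (_+_ G a b) ≡ _+_ H (φ a) (φ b)

record Sub (G : FinAbGroup) : Set₁ where
  field
    Mem  : Carrier G → Set
    mem? : Decidable Mem
    mem0 : Mem (0g G)
open Sub public

whole : (G : FinAbGroup) → Sub G
whole G = record { Mem = λ _ → FinAbGroup.Carrier G ; mem? = λ x → yes x ; mem0 = 0g G }

-- p-component: elements x with p^e · x = 0 for some e.  The exponent is
-- bounded by |G| (harmless: an element of p-power order p^f has p^f ≤ |G|),
-- which makes membership decidable.
pMem : (G : FinAbGroup) → ℕ → Carrier G → Set
pMem G p x = ∃ λ (e : Fin (suc (order G))) → _·_ G (p ^ toℕ e) x ≡ 0g G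

pComp : (G : FinAbGroup) → ℕ → Sub G
pComp G p = record
  { Mem  = pMem G p
  ; mem? = λ x → FinP.any? (λ e → _≟_ G (_·_ G (p ^ toℕ e) x) (0g G))
  ; mem0 = Fin.zero , IsAbelianGroup.identityʳ (isAbelianGroup G) (0g G)
  }
  where import Data.Fin as Fin

allVecs : {A : Set} (k : ℕ) → List A → List (Vec A k)
allVecs zero    L = [] ∷ []
allVecs (suc k) L = concatMap (λ a → map (a ∷_) (allVecs k L)) L

elemsOf : {G : FinAbGroup} → Sub G → List (Carrier G)
elemsOf {G} S = filter (mem? S) (elems G)

size : {G : FinAbGroup} → Sub G → ℕ
size S = length (elemsOf S)

nonZero-∈ : {A : Set} {x : A} {L : List A} → x ∈ L → NonZero (length L)
nonZero-∈ {L = _ ∷ _} _ = _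

|S|≢0 : {G : FinAbGroup} (S : Sub G) → NonZero (size S)
|S|≢0 {G} S = nonZero-∈ (∈-filter⁺ (mem? S) (elems-complete G (0g G)) (mem0 S))

module _ {G H : FinAbGroup} where

  -- A map S → T is represented by its value table along elemsOf S.
  Table : Sub G → Set
  Table S = Vec (Carrier H) (length (elemsOf S))

  evalAux : (L : List (Carrier G)) → Vec (Carrier H) (length L) → Carrier G → Carrier H
  evalAux []       []       x = 0g H
  evalAux (a ∷ L)  (v ∷ vs) x with _≟_ G a x
  ... | yes _ = v
  ... | no  _ = evalAux L vs x

  -- evaluation of a table (meaningful on elements of S)
  eval : (S : Sub G) → Table S → Carrier G → Carrier H
  eval S = evalAux (elemsOf S)

  maps : (S : Sub G) (T : Sub H) → List (Table S)
  maps S T = allVecs (length (elemsOf S)) (elemsOf T)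

  IsHomTable : (S : Sub G) → Table S → Set
  IsHomTable S ψ = LAll.All (λ a → LAll.All (λ b →
    eval S ψ (_+_ G a b) ≡ _+_ H (eval S ψ a) (eval S ψ b)) (elemsOf S)) (elemsOf S)

  isHomTable? : (S : Sub G) → Decidable (IsHomTable S)
  isHomTable? S ψ = LAll.all? (λ a → LAll.all? (λ b →
    _≟_ H (eval S ψ (_+_ G a b)) (_+_ H (eval S ψ a) (eval S ψ b))) (elemsOf S)) (elemsOf S)

  Homs : (S : Sub G) (T : Sub H) → List (Table S)
  Homs S T = filter (isHomTable? S) (maps S T)

  kerSize : (S : Sub G) (T : Sub H) {k : ℕ} → Vec (Carrier G) k → ℕ
  kerSize S T x = length (filter (λ ψ → VAll.all? (λ xi → _≟_ H (eval S ψ xi) (0g H)) x) (Homs S T))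

  γ : (k : ℕ) (S : Sub G) (T : Sub H) → ℕ
  γ k S T = sum (map (kerSize S T) (allVecs k (elemsOf S)))

  Onto : (S : Sub G) (T : Sub H) {k : ℕ} → Vec (Carrier G) k → Set
  Onto S T {k} x = LAll.All (λ y → LAny.Any (λ ψ → Vec.map (eval S ψ) x ≡ y) (Homs S T))
                            (allVecs k (elemsOf T))

  onto? : (S : Sub G) (T : Sub H) {k : ℕ} → Decidable (Onto S T {k})
  onto? S T {k} x = LAll.all? (λ y → LAny.any? (λ ψ → VecP.≡-dec (_≟_ H) (Vec.map (eval S ψ) x) y) (Homs S T))
                              (allVecs k (elemsOf T))

  nonOntoCount : (k : ℕ) (S : Sub G) (T : Sub H) → ℕ
  nonOntoCount k S T = length (filter (λ x → ¬? (onto? S T x)) (allVecs k (elemsOf S)))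

  η : (k : ℕ) (S : Sub G) (T : Sub H) → ℚ
  η k S T = (+ nonOntoCount k S T) ℚ./ (size S ^ k)
    where instance _ = |S|≢0 S
                   _ = m^n≢0 (size S) k

-- Primes p ≤ N (all primes that can divide |G|·|H| when N = |G|·|H|)

primesUpTo : ℕ → List ℕ
primesUpTo N = filter prime? (upTo (suc N))

productℚ : List ℚ → ℚ
productℚ = foldr ℚ._*_ 1ℚ

-- For coprime a and b, multiplication by idempotents c, d of ℤ/ab splits the ab-torsion of a
-- finite abelian group as the direct sum of its a- and b-torsion, and every homomorphism respects
-- the splitting.  Hence Hom(L, M) ≅ Hom(L₁, M₁) × Hom(L₂, M₂) and Lᵏ ≅ L₁ᵏ × L₂ᵏ, compatibly with
-- the kernel of Γₓ and with surjectivity of Γₓ; so |L|, γₖ and the number of x with Γₓ onto are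
-- multiplicative.  The whole group is the (∏_{p ≤ |G||H|} p)^E-torsion, and splitting off one
-- prime at a time gives the product formulas; 1 − ηₖ is the onto count divided by |G|ᵏ.

module Submission where

open import Defs

open import Level using (0ℓ)
open import Algebra.Bundles using (AbelianGroup)
import Algebra.Properties.CommutativeSemigroup as CommutativeSemigroupProperties
import Algebra.Properties.Group as GroupProperties
import Algebra.Properties.Loop as LoopProperties
open import Data.Empty using (⊥-elim)
open import Data.Fin as Fin using (Fin; zero; suc; toℕ; fromℕ<)
import Data.Fin.Properties as Fin
import Data.Integer as ℤ
import Data.Integer.Properties as ℤ
import Data.Integer.Solver as ℤSolver
open import Data.List using (List; []; _∷_; length; map; filter; lookup; concatMap; cartesianProduct; cartesianProductWith; _++_; upTo)
open import Data.List.Membership.Propositional using (_∈_; _∉_; find; lose)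
open import Data.List.Membership.Propositional.Properties
  using ( ∈-lookup; ∈-filter⁺; ∈-filter⁻; ∈-upTo⁺; ∈-cartesianProduct⁺; ∈-cartesianProduct⁻
        ; ∈-cartesianProductWith⁺; ∈-cartesianProductWith⁻)
open import Data.List.Properties using (length-++; length-map; filter-++; map-cong)
import Data.List.Relation.Unary.All as LAll
import Data.List.Relation.Unary.Any as LAny
open import Data.List.Relation.Unary.Any using (here; there; index)
open import Data.List.Relation.Unary.Any.Properties using (lookup-index)
open import Data.List.Relation.Unary.AllPairs using ([]; _∷_)
open import Data.List.Relation.Unary.Unique.Propositional using (Unique)
import Data.List.Relation.Unary.Unique.Propositional.Properties as Unique
open import Data.Nat as ℕ using (ℕ; zero; suc; _*_; _^_; _∸_; _≤_; s≤s; z≤n; NonZero)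
open import Data.Nat.Coprimality as Coprime using (Coprime; coprime-divisor; coprime-Bézout; 1-coprimeTo; 0-coprimeTo-m⇒m≡1)
open import Data.Nat.Divisibility
  using ( _∣_; divides; _∣?_; ∣-trans; ∣-reflexive; ∣1⇒≡1; _∣0; 1∣_; ∣⇒≤
        ; m∣m*n; n∣m*n; *-pres-∣; *-monoʳ-∣; *-cancelʳ-∣)
open import Data.Nat.GCD using (gcd; gcd-GCD; gcd[m,n]∣m; gcd[m,n]∣n; module Bézout)
open import Data.Nat.ListAction using (sum; product)
open import Data.Nat.ListAction.Properties using (∈⇒∣product)
open import Data.Nat.Primality using (Prime; prime?; prime⇒irreducible; prime⇒nonZero; prime⇒nonTrivial; productOfPrimes≥1)
open import Data.Nat.Primality.Factorisation using (factorise; PrimeFactorisation)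
open import Data.Nat.Properties as ℕ
  using ( ≤-antisym; ≤-trans; ≤-reflexive; ≤-pred; <⇒≢; m≤n⇒m≤1+n; m≤m+n; m≤n+m; +-suc; +-identityʳ; +-monoˡ-≤
        ; *-comm; *-identityˡ; *-identityʳ; *-monoˡ-≤; *-monoʳ-≤; m*n≢0; m^n>0; m^n≢0; ^-zeroˡ; ^-distribˡ-+-*
        ; m+[n∸m]≡n; m∸n+n≡m; m∸n≤m)
open import Data.Nat.Solver using (module +-*-Solver)
open import Data.Product using (∃; _×_; _,_; proj₁; proj₂)
open import Data.Rational as ℚ using (1ℚ; _/_; _-_; toℚᵘ)
open import Data.Rational.Properties using (/-cong; toℚᵘ-injective; toℚᵘ-fromℚᵘ; toℚᵘ-homo-*; toℚᵘ-homo-+; toℚᵘ-homo‿-)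
import Data.Rational.Unnormalised as ℚᵘ
import Data.Rational.Unnormalised.Properties as ℚᵘ
open import Data.Sum using (inj₁; inj₂)
open import Data.Vec as Vec using (Vec; []; _∷_)
import Data.Vec.Properties as Vec
import Data.Vec.Relation.Unary.All as VAll
import Data.Vec.Relation.Unary.All.Properties as VAllP
open import Function using (_∘′_)
open import Relation.Binary.PropositionalEquality
open import Relation.Nullary using (Dec; yes; no; ¬_; ¬?)
open import Relation.Unary using (Decidable)

module _ {A : Set} where

  lookup-injective : ∀ {xs : List A} → Unique xs → ∀ {i j} → lookup xs i ≡ lookup xs j → i ≡ j
  lookup-injective {_ ∷ _} _             {zero}  {zero}  _  = refl
  lookup-injective {_ ∷ _} (x∉xs ∷ _)   {zero}  {suc j} eq = ⊥-elim (LAll.lookup x∉xs (∈-lookup j) eq)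
  lookup-injective {_ ∷ _} (x∉xs ∷ _)   {suc i} {zero}  eq = ⊥-elim (LAll.lookup x∉xs (∈-lookup i) (sym eq))
  lookup-injective {_ ∷ _} (_ ∷ unique) {suc i} {suc j} eq = cong suc (lookup-injective unique eq)

length-≤-via-injection : {A B : Set} {xs : List A} {ys : List B} (R : A → B → Set) → Unique xs →
  (∀ {a a' b} → R a b → R a' b → a ≡ a') →
  (∀ {a} → a ∈ xs → ∃ λ b → b ∈ ys × R a b) → length xs ≤ length ys
length-≤-via-injection {xs = xs} {ys} R unique R-injective image = Fin.injective⇒≤ {f = g} g-injective
  where
  g : Fin (length xs) → Fin (length ys)
  g i = index (proj₁ (proj₂ (image (∈-lookup i))))
  g-injective : ∀ {i j} → g i ≡ g j → i ≡ j
  g-injective {i} {j} gi≡gj with image (∈-lookup i) | image (∈-lookup j)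
  ... | b , b∈ys , Rib | b' , b'∈ys , Rjb' = lookup-injective unique (R-injective Rib (subst (R _) (sym b≡b') Rjb'))
    where
    b≡b' : b ≡ b'
    b≡b' = trans (lookup-index b∈ys) (trans (cong (lookup ys) gi≡gj) (sym (lookup-index b'∈ys)))

module _ {A B : Set} where

  length-≡-via-bijection : {xs : List A} {ys : List B} (f : A → B) → Unique xs → Unique ys →
    (∀ {a a'} → a ∈ xs → a' ∈ xs → f a ≡ f a' → a ≡ a') →
    (∀ {a} → a ∈ xs → f a ∈ ys) →
    (∀ {b} → b ∈ ys → ∃ λ a → a ∈ xs × f a ≡ b) → length xs ≡ length ys
  length-≡-via-bijection {xs} f unique-xs unique-ys injective into onto = ≤-antisym
    (length-≤-via-injection (λ a b → a ∈ xs × f a ≡ b) unique-xs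
      (λ (a∈xs , fa≡b) (a'∈xs , fa'≡b) → injective a∈xs a'∈xs (trans fa≡b (sym fa'≡b)))
      (λ a∈xs → f _ , into a∈xs , a∈xs , refl))
    (length-≤-via-injection (λ b a → f a ≡ b) unique-ys (λ fa≡b fa≡b' → trans (sym fa≡b) fa≡b') onto)

  length-cartesianProductWith : ∀ {C : Set} (f : A → B → C) xs ys →
    length (cartesianProductWith f xs ys) ≡ length xs * length ys
  length-cartesianProductWith f []       ys = refl
  length-cartesianProductWith f (x ∷ xs) ys = trans (length-++ (map (f x) ys))
    (cong₂ ℕ._+_ (length-map (f x) ys) (length-cartesianProductWith f xs ys))

module _ {A B C : Set} where

  length-≡-*-via-bijection : {xs : List A} {ys : List B} {zs : List C} (f : A → B × C) →
    Unique xs → Unique ys → Unique zs →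
    (∀ {a a'} → a ∈ xs → a' ∈ xs → f a ≡ f a' → a ≡ a') →
    (∀ {a} → a ∈ xs → proj₁ (f a) ∈ ys × proj₂ (f a) ∈ zs) →
    (∀ {b c} → b ∈ ys → c ∈ zs → ∃ λ a → a ∈ xs × f a ≡ (b , c)) →
    length xs ≡ length ys * length zs
  length-≡-*-via-bijection {ys = ys} {zs} f unique-xs unique-ys unique-zs injective into onto =
    trans (length-≡-via-bijection f unique-xs (Unique.cartesianProduct⁺ unique-ys unique-zs) injective
             (λ a∈xs → let b∈ys , c∈zs = into a∈xs in ∈-cartesianProduct⁺ b∈ys c∈zs)
             (λ bc∈ → let b∈ys , c∈zs = ∈-cartesianProduct⁻ ys zs bc∈ in onto b∈ys c∈zs))
          (length-cartesianProductWith _,_ ys zs)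

module _ {A : Set} where

  length≡1 : {xs : List A} (c : A) → Unique xs → c ∈ xs → (∀ {a} → a ∈ xs → a ≡ c) → length xs ≡ 1
  length≡1 c unique c∈xs all≡c = length-≡-via-bijection (λ a → a) unique (LAll.[] ∷ [])
    (λ a∈xs a'∈xs _ → trans (all≡c a∈xs) (sym (all≡c a'∈xs)))
    (λ a∈xs → here (all≡c a∈xs))
    (λ { (here refl) → c , c∈xs , refl })

  length-filter-+-length-filter-¬ : {P : A → Set} (P? : Decidable P) (xs : List A) →
    length (filter P? xs) ℕ.+ length (filter (λ x → ¬? (P? x)) xs) ≡ length xs
  length-filter-+-length-filter-¬ P? []       = refl
  length-filter-+-length-filter-¬ P? (x ∷ xs) with P? x
  ... | yes _ = cong suc (length-filter-+-length-filter-¬ P? xs)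
  ... | no  _ = trans (+-suc _ _) (cong suc (length-filter-+-length-filter-¬ P? xs))

  allVecs-suc : ∀ k (xs : List A) → allVecs (suc k) xs ≡ cartesianProductWith _∷_ xs (allVecs k xs)
  allVecs-suc k xs = consAll xs
    where
    consAll : ∀ ys → concatMap (λ a → map (a ∷_) (allVecs k xs)) ys ≡ cartesianProductWith _∷_ ys (allVecs k xs)
    consAll []       = refl
    consAll (y ∷ ys) = cong (map (y ∷_) (allVecs k xs) ++_) (consAll ys)

  length-allVecs : ∀ k (xs : List A) → length (allVecs k xs) ≡ length xs ^ k
  length-allVecs zero    xs = refl
  length-allVecs (suc k) xs = begin
    length (allVecs (suc k) xs)                          ≡⟨ cong length (allVecs-suc k xs) ⟩
    length (cartesianProductWith _∷_ xs (allVecs k xs))  ≡⟨ length-cartesianProductWith _∷_ xs (allVecs k xs) ⟩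
    length xs * length (allVecs k xs)                  ≡⟨ cong (length xs *_) (length-allVecs k xs) ⟩
    length xs ^ suc k                                    ∎
    where open ≡-Reasoning

  ∈-allVecs⁺ : ∀ {k} {xs : List A} {v : Vec A k} → VAll.All (_∈ xs) v → v ∈ allVecs k xs
  ∈-allVecs⁺ {v = []}    VAll.[]             = here refl
  ∈-allVecs⁺ {suc k} {xs} (x∈xs VAll.∷ v∈xs) =
    subst (_ ∈_) (sym (allVecs-suc k xs)) (∈-cartesianProductWith⁺ _∷_ x∈xs (∈-allVecs⁺ v∈xs))

  ∈-allVecs⁻ : ∀ {k} {xs : List A} {v : Vec A k} → v ∈ allVecs k xs → VAll.All (_∈ xs) v
  ∈-allVecs⁻ {zero}  {v = []} _ = VAll.[]
  ∈-allVecs⁻ {suc k} {xs} v∈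
    with _ , _ , x∈xs , w∈ , refl ← ∈-cartesianProductWith⁻ _∷_ xs (allVecs k xs) (subst (_ ∈_) (allVecs-suc k xs) v∈)
    = x∈xs VAll.∷ ∈-allVecs⁻ w∈

  allVecs-unique : ∀ k {xs : List A} → Unique xs → Unique (allVecs k xs)
  allVecs-unique zero    _      = LAll.[] ∷ []
  allVecs-unique (suc k) {xs} unique = subst Unique (sym (allVecs-suc k xs))
    (Unique.cartesianProductWith⁺ _∷_ (λ eq → Vec.∷-injectiveˡ eq , Vec.∷-injectiveʳ eq) unique (allVecs-unique k unique))

module _ {A B : Set} {P : A → B → Set} (P? : ∀ a b → Dec (P a b)) where

  sum-length-filter≡length-filter-cartesianProduct : ∀ (xs : List A) (ys : List B) →
    sum (map (λ a → length (filter (P? a) ys)) xs)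
      ≡ length (filter (λ ab → P? (proj₁ ab) (proj₂ ab)) (cartesianProduct xs ys))
  sum-length-filter≡length-filter-cartesianProduct []       ys = refl
  sum-length-filter≡length-filter-cartesianProduct (x ∷ xs) ys = begin
    length (filter (P? x) ys) ℕ.+ sum (map (λ a → length (filter (P? a) ys)) xs)
      ≡⟨ cong₂ ℕ._+_ (row ys) (sum-length-filter≡length-filter-cartesianProduct xs ys) ⟩
    length (filter P?ᵤ (map (x ,_) ys)) ℕ.+ length (filter P?ᵤ (cartesianProduct xs ys))
      ≡⟨ length-++ (filter P?ᵤ (map (x ,_) ys)) ⟨
    length (filter P?ᵤ (map (x ,_) ys) ++ filter P?ᵤ (cartesianProduct xs ys))
      ≡⟨ cong length (filter-++ P?ᵤ (map (x ,_) ys) (cartesianProduct xs ys)) ⟨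
    length (filter P?ᵤ (cartesianProduct (x ∷ xs) ys)) ∎
    where
    open ≡-Reasoning
    P?ᵤ : (ab : A × B) → Dec (P (proj₁ ab) (proj₂ ab))
    P?ᵤ ab = P? (proj₁ ab) (proj₂ ab)
    row : ∀ ys → length (filter (P? x) ys) ≡ length (filter P?ᵤ (map (x ,_) ys))
    row []       = refl
    row (y ∷ ys) with P? x y
    ... | yes _ = cong suc (row ys)
    ... | no  _ = row ys

module _ {A B : Set} where

  map-cong-on : ∀ {P : A → Set} {f g : A → B} → (∀ {a} → P a → f a ≡ g a) →
    ∀ {k} {v : Vec A k} → VAll.All P v → Vec.map f v ≡ Vec.map g v
  map-cong-on f≗g VAll.[]         = refl
  map-cong-on f≗g (pa VAll.∷ pas) = cong₂ _∷_ (f≗g pa) (map-cong-on f≗g pas)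

  zipWith-map-on : ∀ {P : A → Set} {f : B → B → A} {g h : A → B} → (∀ {a} → P a → f (g a) (h a) ≡ a) →
    ∀ {k} {v : Vec A k} → VAll.All P v → Vec.zipWith f (Vec.map g v) (Vec.map h v) ≡ v
  zipWith-map-on inverse VAll.[]         = refl
  zipWith-map-on inverse (pa VAll.∷ pas) = cong₂ _∷_ (inverse pa) (zipWith-map-on inverse pas)

module _ {A B C : Set} where

  map-zipWith-on : ∀ {P : A → Set} {Q : B → Set} {D E : Set} {f : C → D} {g : A → B → C}
    {h : E → E → D} {f₁ : A → E} {f₂ : B → E} →
    (∀ {a b} → P a → Q b → f (g a b) ≡ h (f₁ a) (f₂ b)) →
    ∀ {k} {xs : Vec A k} {ys : Vec B k} → VAll.All P xs → VAll.All Q ys →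
    Vec.map f (Vec.zipWith g xs ys) ≡ Vec.zipWith h (Vec.map f₁ xs) (Vec.map f₂ ys)
  map-zipWith-on eq VAll.[]         VAll.[]         = refl
  map-zipWith-on eq (pa VAll.∷ pas) (qb VAll.∷ qbs) = cong₂ _∷_ (eq pa qb) (map-zipWith-on eq pas qbs)

module _ {A : Set} where

  All-≡⇒replicate : ∀ {c : A} {k} {v : Vec A k} → VAll.All (_≡ c) v → v ≡ Vec.replicate k c
  All-≡⇒replicate VAll.[]              = refl
  All-≡⇒replicate (a≡c VAll.∷ as≡c) = cong₂ _∷_ a≡c (All-≡⇒replicate as≡c)

  All-replicate : ∀ {P : A → Set} {c} k → P c → VAll.All P (Vec.replicate k c)
  All-replicate zero    _  = VAll.[]
  All-replicate (suc k) pc = pc VAll.∷ All-replicate k pc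

prime⇒2≤ : ∀ {p} → Prime p → 2 ≤ p
prime⇒2≤ {p} p-prime = ℕ.nonTrivial⇒n>1 p {{prime⇒nonTrivial p-prime}}

prime∤⇒coprime : ∀ {p n} → Prime p → ¬ p ∣ n → Coprime p n
prime∤⇒coprime p-prime p∤n (d∣p , d∣n) with prime⇒irreducible p-prime d∣p
... | inj₁ d≡1    = d≡1
... | inj₂ refl   = ⊥-elim (p∤n d∣n)

distinct-primes⇒coprime : ∀ {p q} → Prime p → Prime q → p ≢ q → Coprime p q
distinct-primes⇒coprime {p} {q} p-prime q-prime p≢q = prime∤⇒coprime p-prime p∤q
  where
  p∤q : ¬ p ∣ q
  p∤q p∣q with prime⇒irreducible q-prime p∣q
  ... | inj₁ p≡1 = <⇒≢ (prime⇒2≤ p-prime) (sym p≡1)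
  ... | inj₂ p≡q = p≢q p≡q

coprime-*ʳ : ∀ {a b c} → Coprime a b → Coprime a c → Coprime a (b * c)
coprime-*ʳ {a} {b} a⊥b a⊥c {i} (i∣a , i∣bc) = a⊥c (i∣a , coprime-divisor i⊥b i∣bc)
  where
  i⊥b : Coprime i b
  i⊥b (j∣i , j∣b) = a⊥b (∣-trans j∣i i∣a , j∣b)

coprime-^ʳ : ∀ {a b} → Coprime a b → ∀ e → Coprime a (b ^ e)
coprime-^ʳ {a} a⊥b zero    = Coprime.sym (1-coprimeTo a)
coprime-^ʳ     a⊥b (suc e) = coprime-*ʳ a⊥b (coprime-^ʳ a⊥b e)

coprime-^ : ∀ {a b} → Coprime a b → ∀ m n → Coprime (a ^ m) (b ^ n)
coprime-^ a⊥b m n = Coprime.sym (coprime-^ʳ (Coprime.sym (coprime-^ʳ a⊥b n)) m)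

prime-coprime-product : ∀ {p qs} → Prime p → LAll.All Prime qs → p ∉ qs → Coprime p (product qs)
prime-coprime-product {p} p-prime LAll.[]                 _     = Coprime.sym (1-coprimeTo p)
prime-coprime-product     p-prime (q-prime LAll.∷ prime) p∉qqs = coprime-*ʳ
  (distinct-primes⇒coprime p-prime q-prime (p∉qqs ∘′ here))
  (prime-coprime-product p-prime prime (p∉qqs ∘′ there))

∣prime^⇒≡prime^ : ∀ {p} → Prime p → ∀ e {g} → g ∣ p ^ e → ∃ λ f → f ≤ e × g ≡ p ^ f
∣prime^⇒≡prime^ p-prime zero g∣1 = 0 , z≤n , ∣1⇒≡1 g∣1
∣prime^⇒≡prime^ {p} p-prime (suc e) {g} g∣p^suc-e with p ∣? g
... | yes (divides q refl) =
  let instance _ = prime⇒nonZero p-prime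
      f , f≤e , q≡p^f = ∣prime^⇒≡prime^ p-prime e {q} (*-cancelʳ-∣ p (subst (q * p ∣_) (*-comm p (p ^ e)) g∣p^suc-e))
  in suc f , s≤s f≤e , trans (cong (_* p) q≡p^f) (*-comm (p ^ f) p)
... | no p∤g =
  let f , f≤e , g≡p^f = ∣prime^⇒≡prime^ p-prime e (coprime-divisor (Coprime.sym (prime∤⇒coprime p-prime p∤g)) g∣p^suc-e)
  in f , m≤n⇒m≤1+n f≤e , g≡p^f

suc-≤-double : ∀ {m n} → 2 ≤ m → 1 ≤ n → suc n ≤ m * n
suc-≤-double {m} {n} 2≤m 1≤n = begin
  suc n     ≤⟨ +-monoˡ-≤ n 1≤n ⟩
  n ℕ.+ n   ≡⟨ cong (n ℕ.+_) (sym (+-identityʳ n)) ⟩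
  2 * n     ≤⟨ *-monoˡ-≤ n 2≤m ⟩
  m * n     ∎
  where open ℕ.≤-Reasoning

n≤m^n : ∀ {m} → 2 ≤ m → ∀ n → n ≤ m ^ n
n≤m^n 2≤m zero    = z≤n
n≤m^n {m} 2≤m (suc n) = ≤-trans (s≤s (n≤m^n 2≤m n))
  (suc-≤-double 2≤m (m^n>0 m {{ℕ.>-nonZero (≤-trans (s≤s z≤n) 2≤m)}} n))

length≤product : ∀ {ps} → LAll.All Prime ps → length ps ≤ product ps
length≤product LAll.[] = z≤n
length≤product (p-prime LAll.∷ prime) =
  ≤-trans (s≤s (length≤product prime)) (suc-≤-double (prime⇒2≤ p-prime) (productOfPrimes≥1 prime))

^-distribʳ-* : ∀ m n e → (m * n) ^ e ≡ m ^ e * n ^ e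
^-distribʳ-* m n zero    = refl
^-distribʳ-* m n (suc e) = trans (cong (m * n *_) (^-distribʳ-* m n e)) (interchange m n (m ^ e) (n ^ e))
  where
  open +-*-Solver
  interchange : ∀ a b c d → a * b * (c * d) ≡ a * c * (b * d)
  interchange = solve 4 (λ a b c d → a :* b :* (c :* d) := a :* c :* (b :* d)) refl

^-monoʳ-∣ : ∀ a {m n} → m ≤ n → a ^ m ∣ a ^ n
^-monoʳ-∣ a {m} {n} m≤n = subst (a ^ m ∣_)
  (trans (sym (^-distribˡ-+-* a m (n ∸ m))) (cong (a ^_) (m+[n∸m]≡n m≤n))) (m∣m*n _)

product∣product^length : ∀ {qs ns} → LAll.All (_∈ qs) ns → product ns ∣ product qs ^ length ns
product∣product^length LAll.[]             = 1∣ 1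
product∣product^length (n∈qs LAll.∷ ∈qs) = *-pres-∣ (∈⇒∣product n∈qs) (product∣product^length ∈qs)

primorial : ℕ → ℕ
primorial N = product (primesUpTo N)

∈-primesUpTo : ∀ {N p} → Prime p → p ≤ N → p ∈ primesUpTo N
∈-primesUpTo p-prime p≤N = ∈-filter⁺ prime? (∈-upTo⁺ (s≤s p≤N)) p-prime

-- Every prime factor of n is at most N, and there are at most n ≤ E of them.
∣primorial^ : ∀ {N E n} → 1 ≤ n → n ≤ N → n ≤ E → n ∣ primorial N ^ E
∣primorial^ {N} {E} {n@(suc _)} _ n≤N n≤E = subst (_∣ primorial N ^ E) (sym n≡∏ps)
  (∣-trans (product∣product^length ps∈primes) (^-monoʳ-∣ (primorial N) |ps|≤E))
  where
  open PrimeFactorisation (factorise n) renaming (factors to ps; isFactorisation to n≡∏ps; factorsPrime to ps-prime)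
  ps∈primes : LAll.All (_∈ primesUpTo N) ps
  ps∈primes = LAll.tabulate λ {p} p∈ps → ∈-primesUpTo (LAll.lookup ps-prime p∈ps)
    (≤-trans (∣⇒≤ (subst (p ∣_) (sym n≡∏ps) (∈⇒∣product p∈ps))) n≤N)
  |ps|≤E : length ps ≤ E
  |ps|≤E = ≤-trans (length≤product ps-prime) (≤-trans (≤-reflexive (sym n≡∏ps)) n≤E)

primesUpTo-prime : ∀ N → LAll.All Prime (primesUpTo N)
primesUpTo-prime N = LAll.tabulate λ p∈ → proj₂ (∈-filter⁻ prime? {xs = upTo (suc N)} p∈)

primesUpTo-unique : ∀ N → Unique (primesUpTo N)
primesUpTo-unique N = Unique.filter⁺ prime? (Unique.upTo⁺ (suc N))

product-map-^ : ∀ (s : ℕ → ℕ) k qs → product (map s qs) ^ k ≡ product (map (λ q → s q ^ k) qs)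
product-map-^ s k []       = ^-zeroˡ k
product-map-^ s k (q ∷ qs) = trans (^-distribʳ-* (s q) (product (map s qs)) k) (cong (s q ^ k *_) (product-map-^ s k qs))

-- Multiples and element orders

abelianGroup : FinAbGroup → AbelianGroup 0ℓ 0ℓ
abelianGroup K = record { isAbelianGroup = FinAbGroup.isAbelianGroup K }

module Multiples (K : FinAbGroup) where

  open FinAbGroup K
  open AbelianGroup (abelianGroup K) using (assoc)
  open AbelianGroup (abelianGroup K) public using (identityˡ; identityʳ)
  open LoopProperties (GroupProperties.loop (AbelianGroup.group (abelianGroup K))) public using (identityˡ-unique)
  open CommutativeSemigroupProperties (AbelianGroup.commutativeSemigroup (abelianGroup K)) public using (interchange)

  _annihilates_ : ℕ → Carrier → Set
  n annihilates x = n · x ≡ 0g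

  ·-homo-+ : ∀ m n x → (m ℕ.+ n) · x ≡ m · x + n · x
  ·-homo-+ zero    n x = sym (identityˡ (n · x))
  ·-homo-+ (suc m) n x = trans (cong (x +_) (·-homo-+ m n x)) (sym (assoc x (m · x) (n · x)))

  ·-zeroʳ : ∀ n → n · 0g ≡ 0g
  ·-zeroʳ zero    = refl
  ·-zeroʳ (suc n) = trans (identityˡ (n · 0g)) (·-zeroʳ n)

  ·-distrib-+ : ∀ n x y → n · (x + y) ≡ n · x + n · y
  ·-distrib-+ zero    x y = sym (identityʳ 0g)
  ·-distrib-+ (suc n) x y = trans (cong ((x + y) +_) (·-distrib-+ n x y)) (interchange x y (n · x) (n · y))

  ·-assoc : ∀ m n x → (m * n) · x ≡ m · (n · x)
  ·-assoc zero    n x = refl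
  ·-assoc (suc m) n x = trans (·-homo-+ n (m * n) x) (cong (n · x +_) (·-assoc m n x))

  annihilates-*ˡ : ∀ {m x} n → m annihilates x → (n * m) annihilates x
  annihilates-*ˡ {m} {x} n mx≡0 = trans (·-assoc n m x) (trans (cong (n ·_) mx≡0) (·-zeroʳ n))

  annihilates-∣ : ∀ {m n x} → m ∣ n → m annihilates x → n annihilates x
  annihilates-∣ (divides q refl) = annihilates-*ˡ q

  annihilates-+ : ∀ n {x y} → n annihilates x → n annihilates y → n annihilates (x + y)
  annihilates-+ n {x} {y} nx≡0 ny≡0 = trans (·-distrib-+ n x y) (trans (cong₂ _+_ nx≡0 ny≡0) (identityʳ 0g))

  annihilates-0 : ∀ n → n annihilates 0g
  annihilates-0 = ·-zeroʳ

  -- Bézout: gcd m n + v n = u m (or symmetrically), and both u m and v n annihilate x.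
  annihilates-gcd : ∀ {m n x} → m annihilates x → n annihilates x → gcd m n annihilates x
  annihilates-gcd {m} {n} {x} mx≡0 nx≡0 with Bézout.identity (gcd-GCD m n)
  ... | Bézout.+- u v eq = identityˡ-unique _ _ (begin
    gcd m n · x + (v * n) · x ≡⟨ ·-homo-+ (gcd m n) (v * n) x ⟨
    (gcd m n ℕ.+ v * n) · x   ≡⟨ cong (_· x) eq ⟩
    (u * m) · x               ≡⟨ annihilates-*ˡ u mx≡0 ⟩
    0g                        ≡⟨ annihilates-*ˡ v nx≡0 ⟨
    (v * n) · x               ∎)
    where open ≡-Reasoning
  ... | Bézout.-+ u v eq = identityˡ-unique _ _ (begin
    gcd m n · x + (u * m) · x ≡⟨ ·-homo-+ (gcd m n) (u * m) x ⟨
    (gcd m n ℕ.+ u * m) · x   ≡⟨ cong (_· x) eq ⟩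
    (v * n) · x               ≡⟨ annihilates-*ˡ v nx≡0 ⟩
    0g                        ≡⟨ annihilates-*ˡ u mx≡0 ⟨
    (u * m) · x               ∎)
    where open ≡-Reasoning

module Orders (K : FinAbGroup) where

  open FinAbGroup K
  open Multiples K

  -- Pigeonhole on 0·x, 1·x, …, |K|·x gives i < j with i·x = j·x.
  ∃-annihilator : ∀ x → ∃ λ n → 1 ≤ n × n ≤ order × n annihilates x
  ∃-annihilator x with Fin.pigeonhole (ℕ.n<1+n order) (λ i → index (elems-complete (toℕ i · x)))
  ... | i , j , i<j , same-index = toℕ j ∸ toℕ i , ℕ.m<n⇒0<n∸m i<j ,
        ≤-trans (m∸n≤m (toℕ j) (toℕ i)) (≤-pred (Fin.toℕ<n j)) ,
        identityˡ-unique _ _ (begin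
          (toℕ j ∸ toℕ i) · x + toℕ i · x ≡⟨ ·-homo-+ (toℕ j ∸ toℕ i) (toℕ i) x ⟨
          (toℕ j ∸ toℕ i ℕ.+ toℕ i) · x   ≡⟨ cong (_· x) (m∸n+n≡m (ℕ.<⇒≤ i<j)) ⟩
          toℕ j · x                       ≡⟨ ix≡jx ⟨
          toℕ i · x                       ∎)
    where
    open ≡-Reasoning
    ix≡jx : toℕ i · x ≡ toℕ j · x
    ix≡jx = trans (lookup-index (elems-complete (toℕ i · x)))
              (trans (cong (lookup elems) same-index) (sym (lookup-index (elems-complete (toℕ j · x)))))

  -- The annihilator gcd(n, p^e) is a power p^f ≤ n ≤ |K|, so f ≤ |K| as pMem requires.
  prime^-annihilated⇒pMem : ∀ {p} → Prime p → ∀ e {x} → (p ^ e) annihilates x → pMem K p x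
  prime^-annihilated⇒pMem {p} p-prime e {x} p^ex≡0
    with n , 1≤n , n≤order , nx≡0 ← ∃-annihilator x
    with f , _ , gcd≡p^f ← ∣prime^⇒≡prime^ p-prime e (gcd[m,n]∣n n (p ^ e))
    = fromℕ< (s≤s f≤order) , subst (λ f → (p ^ f) annihilates x) (sym (Fin.toℕ-fromℕ< (s≤s f≤order))) p^fx≡0
    where
    p^fx≡0 : (p ^ f) annihilates x
    p^fx≡0 = subst (_annihilates x) gcd≡p^f (annihilates-gcd {n} {p ^ e} nx≡0 p^ex≡0)
    f≤order : f ≤ order
    f≤order = ≤-trans (n≤m^n (prime⇒2≤ p-prime) f) (≤-trans (≤-reflexive (sym gcd≡p^f))
                (≤-trans (∣⇒≤ {{ℕ.>-nonZero 1≤n}} (gcd[m,n]∣m n (p ^ e))) n≤order))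

  pMem⇒prime^-annihilated : ∀ {p E x} → order ≤ E → pMem K p x → (p ^ E) annihilates x
  pMem⇒prime^-annihilated {p} order≤E (e , p^ex≡0) =
    annihilates-∣ (^-monoʳ-∣ p (≤-trans (≤-pred (Fin.toℕ<n e)) order≤E)) p^ex≡0

  primorial^-annihilates : ∀ {N E} → order ≤ N → order ≤ E → ∀ x → (primorial N ^ E) annihilates x
  primorial^-annihilates order≤N order≤E x =
    let n , 1≤n , n≤order , nx≡0 = ∃-annihilator x
    in annihilates-∣ (∣primorial^ 1≤n (≤-trans n≤order order≤N) (≤-trans n≤order order≤E)) nx≡0

-- Internal direct sums

module _ (K : FinAbGroup) where

  open FinAbGroup K
  open Multiples K

  Closed : List Carrier → Set
  Closed L = ∀ {x y} → x ∈ L → y ∈ L → x + y ∈ L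

  -- Subgroups are represented by duplicate-free enumerations; the projections witness L = L₁ ⊕ L₂.
  record DirectSum (L L₁ L₂ : List Carrier) : Set where
    field
      unique      : Unique L
      unique₁     : Unique L₁
      unique₂     : Unique L₂
      π₁ π₂       : Carrier → Carrier
      π₁∈         : ∀ {x} → x ∈ L → π₁ x ∈ L₁
      π₂∈         : ∀ {x} → x ∈ L → π₂ x ∈ L₂
      π₁+π₂       : ∀ {x} → x ∈ L → π₁ x + π₂ x ≡ x
      +∈          : ∀ {x y} → x ∈ L₁ → y ∈ L₂ → x + y ∈ L
      π₁-+        : ∀ {x y} → x ∈ L₁ → y ∈ L₂ → π₁ (x + y) ≡ x
      π₂-+        : ∀ {x y} → x ∈ L₁ → y ∈ L₂ → π₂ (x + y) ≡ y
      0∈₁         : 0g ∈ L₁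
      0∈₂         : 0g ∈ L₂
      closed₁     : Closed L₁
      closed₂     : Closed L₂

    ⊆₁ : ∀ {x} → x ∈ L₁ → x ∈ L
    ⊆₁ {x} x∈L₁ = subst (_∈ L) (identityʳ x) (+∈ x∈L₁ 0∈₂)

    ⊆₂ : ∀ {x} → x ∈ L₂ → x ∈ L
    ⊆₂ {x} x∈L₂ = subst (_∈ L) (identityˡ x) (+∈ 0∈₁ x∈L₂)

    π₁-on₁ : ∀ {x} → x ∈ L₁ → π₁ x ≡ x
    π₁-on₁ {x} x∈L₁ = subst (λ z → π₁ z ≡ x) (identityʳ x) (π₁-+ x∈L₁ 0∈₂)

    π₂-on₂ : ∀ {x} → x ∈ L₂ → π₂ x ≡ x
    π₂-on₂ {x} x∈L₂ = subst (λ z → π₂ z ≡ x) (identityˡ x) (π₂-+ 0∈₁ x∈L₂)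

    +-componentwise : ∀ {x y} → x ∈ L → y ∈ L → (π₁ x + π₁ y) + (π₂ x + π₂ y) ≡ x + y
    +-componentwise {x} {y} x∈L y∈L =
      trans (interchange (π₁ x) (π₁ y) (π₂ x) (π₂ y)) (cong₂ _+_ (π₁+π₂ x∈L) (π₁+π₂ y∈L))

    closed : Closed L
    closed x∈L y∈L = subst (_∈ L) (+-componentwise x∈L y∈L)
      (+∈ (closed₁ (π₁∈ x∈L) (π₁∈ y∈L)) (closed₂ (π₂∈ x∈L) (π₂∈ y∈L)))

    π₁-homo : ∀ {x y} → x ∈ L → y ∈ L → π₁ (x + y) ≡ π₁ x + π₁ y
    π₁-homo x∈L y∈L = trans (cong π₁ (sym (+-componentwise x∈L y∈L)))
      (π₁-+ (closed₁ (π₁∈ x∈L) (π₁∈ y∈L)) (closed₂ (π₂∈ x∈L) (π₂∈ y∈L)))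

    π₂-homo : ∀ {x y} → x ∈ L → y ∈ L → π₂ (x + y) ≡ π₂ x + π₂ y
    π₂-homo x∈L y∈L = trans (cong π₂ (sym (+-componentwise x∈L y∈L)))
      (π₂-+ (closed₁ (π₁∈ x∈L) (π₁∈ y∈L)) (closed₂ (π₂∈ x∈L) (π₂∈ y∈L)))

    length-directSum : length L ≡ length L₁ * length L₂
    length-directSum = length-≡-*-via-bijection (λ x → π₁ x , π₂ x) unique unique₁ unique₂
      (λ x∈L x'∈L πx≡πx' → trans (sym (π₁+π₂ x∈L))
        (trans (cong₂ _+_ (cong proj₁ πx≡πx') (cong proj₂ πx≡πx')) (π₁+π₂ x'∈L)))
      (λ x∈L → π₁∈ x∈L , π₂∈ x∈L)
      (λ x₁∈L₁ x₂∈L₂ → _ , +∈ x₁∈L₁ x₂∈L₂ , cong₂ _,_ (π₁-+ x₁∈L₁ x₂∈L₂) (π₂-+ x₁∈L₁ x₂∈L₂))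

    map-π₁-on₁ : ∀ {k} {x : Vec Carrier k} → VAll.All (_∈ L₁) x → Vec.map π₁ x ≡ x
    map-π₁-on₁ {x = x} x∈L₁ = trans (map-cong-on π₁-on₁ x∈L₁) (Vec.map-id x)

    map-π₂-on₂ : ∀ {k} {x : Vec Carrier k} → VAll.All (_∈ L₂) x → Vec.map π₂ x ≡ x
    map-π₂-on₂ {x = x} x∈L₂ = trans (map-cong-on π₂-on₂ x∈L₂) (Vec.map-id x)

    join-split : ∀ {k} {x : Vec Carrier k} → VAll.All (_∈ L) x →
      Vec.zipWith _+_ (Vec.map π₁ x) (Vec.map π₂ x) ≡ x
    join-split = zipWith-map-on π₁+π₂

    map-π₁-join : ∀ {k} {x₁ x₂ : Vec Carrier k} → VAll.All (_∈ L₁) x₁ → VAll.All (_∈ L₂) x₂ →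
      Vec.map π₁ (Vec.zipWith _+_ x₁ x₂) ≡ x₁
    map-π₁-join VAll.[]               VAll.[]               = refl
    map-π₁-join (a∈L₁ VAll.∷ x₁∈L₁) (b∈L₂ VAll.∷ x₂∈L₂) =
      cong₂ _∷_ (π₁-+ a∈L₁ b∈L₂) (map-π₁-join x₁∈L₁ x₂∈L₂)

    map-π₂-join : ∀ {k} {x₁ x₂ : Vec Carrier k} → VAll.All (_∈ L₁) x₁ → VAll.All (_∈ L₂) x₂ →
      Vec.map π₂ (Vec.zipWith _+_ x₁ x₂) ≡ x₂
    map-π₂-join VAll.[]               VAll.[]               = refl
    map-π₂-join (a∈L₁ VAll.∷ x₁∈L₁) (b∈L₂ VAll.∷ x₂∈L₂) =
      cong₂ _∷_ (π₂-+ a∈L₁ b∈L₂) (map-π₂-join x₁∈L₁ x₂∈L₂)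

    split-injective : ∀ {k} {x x' : Vec Carrier k} → VAll.All (_∈ L) x → VAll.All (_∈ L) x' →
      Vec.map π₁ x ≡ Vec.map π₁ x' → Vec.map π₂ x ≡ Vec.map π₂ x' → x ≡ x'
    split-injective x∈L x'∈L π₁x≡π₁x' π₂x≡π₂x' =
      trans (sym (join-split x∈L)) (trans (cong₂ (Vec.zipWith _+_) π₁x≡π₁x' π₂x≡π₂x') (join-split x'∈L))

  record EnumeratesTorsion (n : ℕ) (L : List Carrier) : Set where
    field
      annihilated : ∀ {x} → x ∈ L → n annihilates x
      complete    : ∀ {x} → n annihilates x → x ∈ L

    closed : Closed L
    closed x∈L y∈L = complete (annihilates-+ n (annihilated x∈L) (annihilated y∈L))

    0∈ : 0g ∈ L
    0∈ = complete (annihilates-0 n)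

  1-torsion-trivial : ∀ {L} → EnumeratesTorsion 1 L → ∀ {x} → x ∈ L → x ≡ 0g
  1-torsion-trivial L-tor {x} x∈L = trans (sym (identityʳ x)) (EnumeratesTorsion.annihilated L-tor x∈L)

-- c and d are the idempotents of ℤ/ab ≅ ℤ/a × ℤ/b; multiplying by them projects the ab-torsion
-- onto its a- and b-torsion.
record BézoutSplit (a b : ℕ) : Set where
  field
    c d t   : ℕ
    b∣c     : b ∣ c
    a∣d     : a ∣ d
    c+d≡1+t*ab : c ℕ.+ d ≡ 1 ℕ.+ t * (a * b)

bézoutSplit : ∀ {a b} → Coprime a b → BézoutSplit a b
bézoutSplit {zero} 0⊥b = record
  { c = 1 ; d = 0 ; t = 0 ; b∣c = ∣-reflexive (0-coprimeTo-m⇒m≡1 0⊥b) ; a∣d = 0 ∣0 ; c+d≡1+t*ab = refl }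
bézoutSplit {suc a} {zero} a⊥0 = record
  { c = 0 ; d = 1 ; t = 0 ; b∣c = 0 ∣0 ; a∣d = ∣-reflexive (0-coprimeTo-m⇒m≡1 (Coprime.sym a⊥0)) ; c+d≡1+t*ab = refl }
bézoutSplit {suc a} {suc b} a⊥b with coprime-Bézout a⊥b
... | Bézout.+- u v 1+vb≡ua = record
  { c = a * v * suc b ; d = u * suc a ; t = v ; b∣c = n∣m*n (a * v) ; a∣d = n∣m*n u
  ; c+d≡1+t*ab = trans (cong (a * v * suc b ℕ.+_) (sym 1+vb≡ua)) (lemma a v (suc b)) }
  where
  open +-*-Solver
  lemma : ∀ a v b → a * v * b ℕ.+ (1 ℕ.+ v * b) ≡ 1 ℕ.+ v * (suc a * b)
  lemma = solve 3 (λ a v b → a :* v :* b :+ (con 1 :+ v :* b) := con 1 :+ v :* ((con 1 :+ a) :* b)) refl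
... | Bézout.-+ u v 1+ua≡vb = record
  { c = v * suc b ; d = b * u * suc a ; t = u ; b∣c = n∣m*n v ; a∣d = n∣m*n (b * u)
  ; c+d≡1+t*ab = trans (cong (ℕ._+ b * u * suc a) (sym 1+ua≡vb)) (lemma b u (suc a)) }
  where
  open +-*-Solver
  lemma : ∀ b u a → (1 ℕ.+ u * a) ℕ.+ b * u * a ≡ 1 ℕ.+ u * (a * suc b)
  lemma = solve 3 (λ b u a → (con 1 :+ u :* a) :+ b :* u :* a := con 1 :+ u :* (a :* (con 1 :+ b))) refl

module _ (K : FinAbGroup) where

  open FinAbGroup K
  open Multiples K
  open EnumeratesTorsion

  torsionDirectSum : ∀ {a b L L₁ L₂} → BézoutSplit a b → Unique L → Unique L₁ → Unique L₂ →
    EnumeratesTorsion K (a * b) L → EnumeratesTorsion K a L₁ → EnumeratesTorsion K b L₂ →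
    DirectSum K L L₁ L₂
  torsionDirectSum {a} {b} {L} {L₁} {L₂} split unique unique₁ unique₂ L-tor L₁-tor L₂-tor = record
    { unique = unique ; unique₁ = unique₁ ; unique₂ = unique₂
    ; π₁ = c ·_ ; π₂ = d ·_
    ; π₁∈ = λ {x} x∈L → complete L₁-tor
        (trans (sym (·-assoc a c x)) (annihilates-∣ (*-monoʳ-∣ a b∣c) (annihilated L-tor x∈L)))
    ; π₂∈ = λ {x} x∈L → complete L₂-tor
        (trans (sym (·-assoc b d x)) (annihilates-∣ (subst (_∣ b * d) (*-comm b a) (*-monoʳ-∣ b a∣d)) (annihilated L-tor x∈L)))
    ; π₁+π₂ = λ x∈L → c·+d·≡id (annihilated L-tor x∈L)
    ; +∈ = λ x∈L₁ y∈L₂ → complete L-tor (annihilates-+ (a * b) (annihilated₁ x∈L₁) (annihilated₂ y∈L₂))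
    ; π₁-+ = λ {x} {y} x∈L₁ y∈L₂ → trans (·-distrib-+ c x y)
        (trans (cong₂ _+_ (c·-on₁ x∈L₁) (annihilates-∣ b∣c (annihilated L₂-tor y∈L₂))) (identityʳ x))
    ; π₂-+ = λ {x} {y} x∈L₁ y∈L₂ → trans (·-distrib-+ d x y)
        (trans (cong₂ _+_ (annihilates-∣ a∣d (annihilated L₁-tor x∈L₁)) (d·-on₂ y∈L₂)) (identityˡ y))
    ; 0∈₁ = 0∈ L₁-tor
    ; 0∈₂ = 0∈ L₂-tor
    ; closed₁ = closed L₁-tor
    ; closed₂ = closed L₂-tor
    }
    where
    open BézoutSplit split
    annihilated₁ : ∀ {x} → x ∈ L₁ → (a * b) annihilates x
    annihilated₁ x∈L₁ = annihilates-∣ (m∣m*n {a} b) (annihilated L₁-tor x∈L₁)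
    annihilated₂ : ∀ {x} → x ∈ L₂ → (a * b) annihilates x
    annihilated₂ x∈L₂ = annihilates-∣ (n∣m*n a) (annihilated L₂-tor x∈L₂)
    c·+d·≡id : ∀ {x} → (a * b) annihilates x → c · x + d · x ≡ x
    c·+d·≡id {x} abx≡0 = begin
      c · x + d · x             ≡⟨ ·-homo-+ c d x ⟨
      (c ℕ.+ d) · x             ≡⟨ cong (_· x) c+d≡1+t*ab ⟩
      x + (t * (a * b)) · x     ≡⟨ cong (x +_) (annihilates-*ˡ t abx≡0) ⟩
      x + 0g                    ≡⟨ identityʳ x ⟩
      x                         ∎
      where open ≡-Reasoning
    c·-on₁ : ∀ {x} → x ∈ L₁ → c · x ≡ x
    c·-on₁ {x} x∈L₁ = trans (sym (trans (cong (c · x +_) (annihilates-∣ a∣d (annihilated L₁-tor x∈L₁))) (identityʳ (c · x))))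
      (c·+d·≡id (annihilated₁ x∈L₁))
    d·-on₂ : ∀ {x} → x ∈ L₂ → d · x ≡ x
    d·-on₂ {x} x∈L₂ = trans (sym (trans (cong (_+ d · x) (annihilates-∣ b∣c (annihilated L₂-tor x∈L₂))) (identityˡ (d · x))))
      (c·+d·≡id (annihilated₂ x∈L₂))

-- A map out of an enumerated subset L is its table of values along L.  For L = elemsOf S the
-- notions below unfold to Homs, γ and Onto of Defs.
module Tables (G H : FinAbGroup) where

  open FinAbGroup G using () renaming (Carrier to CG; _+_ to _+G_; 0g to 0G; _≟_ to _≟G_)
  open FinAbGroup H using () renaming (Carrier to CH; _+_ to _+H_; 0g to 0H; _≟_ to _≟H_)
  module MG = Multiples G
  module MH = Multiples H

  Tab : List CG → Set
  Tab L = Vec CH (length L)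

  ev : (L : List CG) → Tab L → CG → CH
  ev = evalAux {G} {H}

  table : (L : List CG) → (CG → CH) → Tab L
  table L f = Vec.map f (Vec.fromList L)

  eval-table : ∀ L f {x} → x ∈ L → ev L (table L f) x ≡ f x
  eval-table (a ∷ L) f {x} x∈aL with a ≟G x
  ... | yes refl = refl
  eval-table (a ∷ L) f (here refl) | no a≢x = ⊥-elim (a≢x refl)
  eval-table (a ∷ L) f (there x∈L) | no _   = eval-table L f x∈L

  table-ext : ∀ {L} → Unique L → ∀ {ψ ψ'} → (∀ {x} → x ∈ L → ev L ψ x ≡ ev L ψ' x) → ψ ≡ ψ'
  table-ext {[]}    _              {[]}    {[]}      _      = refl
  table-ext {a ∷ L} (a∉L ∷ unique) {v ∷ ψ} {v' ∷ ψ'} agree = cong₂ _∷_ v≡v' (table-ext unique agree-L)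
    where
    v≡v' : v ≡ v'
    v≡v' with agree (here refl)
    ... | eq with a ≟G a
    ...   | yes _   = eq
    ...   | no  a≢a = ⊥-elim (a≢a refl)
    agree-L : ∀ {x} → x ∈ L → ev L ψ x ≡ ev L ψ' x
    agree-L {x} x∈L with agree (there x∈L)
    ... | eq with a ≟G x
    ...   | yes refl = ⊥-elim (LAll.lookup a∉L x∈L refl)
    ...   | no  _    = eq

  eval-∈ : ∀ {M} L ψ → VAll.All (_∈ M) ψ → ∀ {x} → x ∈ L → ev L ψ x ∈ M
  eval-∈ (a ∷ L) (v ∷ ψ) (v∈M VAll.∷ ψ∈M) {x} x∈aL with a ≟G x
  ... | yes _ = v∈M
  eval-∈ (a ∷ L) (v ∷ ψ) (v∈M VAll.∷ ψ∈M) (here refl) | no a≢x = ⊥-elim (a≢x refl)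
  eval-∈ (a ∷ L) (v ∷ ψ) (v∈M VAll.∷ ψ∈M) (there x∈L) | no _   = eval-∈ L ψ ψ∈M x∈L

  table-∈ : ∀ {M} L f → (∀ {x} → x ∈ L → f x ∈ M) → VAll.All (_∈ M) (table L f)
  table-∈ []      f _     = VAll.[]
  table-∈ (a ∷ L) f f∈M = f∈M (here refl) VAll.∷ table-∈ L f (f∈M ∘′ there)

  record IsHomOn (L : List CG) (M : List CH) (f : CG → CH) : Set where
    field
      into : ∀ {x} → x ∈ L → f x ∈ M
      homo : ∀ {x y} → x ∈ L → y ∈ L → f (x +G y) ≡ f x +H f y

    0↦0 : 0G ∈ L → f 0G ≡ 0H
    0↦0 0∈L = MH.identityˡ-unique (f 0G) (f 0G) (trans (sym (homo 0∈L 0∈L)) (cong f (MG.identityʳ 0G)))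
  open IsHomOn public

  isHomOn? : (L : List CG) (ψ : Tab L) → Dec _
  isHomOn? L ψ = LAll.all? (λ a → LAll.all? (λ b → ev L ψ (a +G b) ≟H (ev L ψ a +H ev L ψ b)) L) L

  HomTables : (L : List CG) → List CH → List (Tab L)
  HomTables L M = filter (isHomOn? L) (allVecs (length L) M)

  HomTables-unique : ∀ {L M} → Unique M → Unique (HomTables L M)
  HomTables-unique {L} unique = Unique.filter⁺ (isHomOn? L) (allVecs-unique (length L) unique)

  ∈HomTables⁻ : ∀ {L M ψ} → ψ ∈ HomTables L M → IsHomOn L M (ev L ψ)
  ∈HomTables⁻ {L} {M} {ψ} ψ∈ with ∈-filter⁻ (isHomOn? L) {xs = allVecs (length L) M} ψ∈
  ... | ψ∈Mᴸ , additive = record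
    { into = eval-∈ L ψ (∈-allVecs⁻ ψ∈Mᴸ)
    ; homo = λ x∈L y∈L → LAll.lookup (LAll.lookup additive x∈L) y∈L }

  table∈HomTables : ∀ {L M f} → Closed G L → IsHomOn L M f → table L f ∈ HomTables L M
  table∈HomTables {L} {M} {f} closed f-hom = ∈-filter⁺ (isHomOn? L) (∈-allVecs⁺ (table-∈ L f (into f-hom)))
    (LAll.tabulate λ x∈L → LAll.tabulate λ y∈L → begin
      ev L (table L f) (_ +G _)            ≡⟨ eval-table L f (closed x∈L y∈L) ⟩
      f (_ +G _)                           ≡⟨ homo f-hom x∈L y∈L ⟩
      f _ +H f _                           ≡⟨ cong₂ _+H_ (eval-table L f x∈L) (eval-table L f y∈L) ⟨
      ev L (table L f) _ +H ev L (table L f) _ ∎)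
    where open ≡-Reasoning

  hom-· : ∀ {L M f} → IsHomOn L M f → Closed G L → 0G ∈ L → ∀ n {x} → x ∈ L →
    FinAbGroup._·_ G n x ∈ L × f (FinAbGroup._·_ G n x) ≡ FinAbGroup._·_ H n (f x)
  hom-· f-hom closed 0∈L zero    x∈L = 0∈L , 0↦0 f-hom 0∈L
  hom-· {f = f} f-hom closed 0∈L (suc n) {x} x∈L with nx∈L , f[nx]≡nfx ← hom-· f-hom closed 0∈L n x∈L =
    closed x∈L nx∈L , trans (homo f-hom x∈L nx∈L) (cong (f x +H_) f[nx]≡nfx)

  hom-preserves-torsion : ∀ {L M L' M' f n} → IsHomOn L M f → Closed G L → 0G ∈ L → (∀ {x} → x ∈ L' → x ∈ L) →
    EnumeratesTorsion G n L' → EnumeratesTorsion H n M' → ∀ {x} → x ∈ L' → f x ∈ M'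
  hom-preserves-torsion {f = f} {n} f-hom closed 0∈L L'⊆L L'-tor M'-tor x∈L' =
    let nx∈L , f[nx]≡nfx = hom-· f-hom closed 0∈L n (L'⊆L x∈L') in
    EnumeratesTorsion.complete M'-tor
      (trans (sym f[nx]≡nfx) (trans (cong f (EnumeratesTorsion.annihilated L'-tor x∈L')) (0↦0 f-hom 0∈L)))

  Γ : (L : List CG) {k : ℕ} → Vec CG k → Tab L → Vec CH k
  Γ L x ψ = Vec.map (ev L ψ) x

  Kills : (L : List CG) {k : ℕ} → Vec CG k → Tab L → Set
  Kills L x ψ = VAll.All (λ xᵢ → ev L ψ xᵢ ≡ 0H) x

  kills? : (L : List CG) {k : ℕ} (x : Vec CG k) (ψ : Tab L) → Dec (Kills L x ψ)
  kills? L x ψ = VAll.all? (λ xᵢ → ev L ψ xᵢ ≟H 0H) x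

  γᴸ : ℕ → List CG → List CH → ℕ
  γᴸ k L M = sum (map (λ x → length (filter (kills? L x) (HomTables L M))) (allVecs k L))

  KernelPairs : (k : ℕ) (L : List CG) (M : List CH) → List (Vec CG k × Tab L)
  KernelPairs k L M = filter (λ xψ → kills? L (proj₁ xψ) (proj₂ xψ)) (cartesianProduct (allVecs k L) (HomTables L M))

  γᴸ≡length-KernelPairs : ∀ k L M → γᴸ k L M ≡ length (KernelPairs k L M)
  γᴸ≡length-KernelPairs k L M = sum-length-filter≡length-filter-cartesianProduct (kills? L) (allVecs k L) (HomTables L M)

  KernelPairs-unique : ∀ k {L M} → Unique L → Unique M → Unique (KernelPairs k L M)
  KernelPairs-unique k {L} uniqueL uniqueM = Unique.filter⁺ (λ xψ → kills? L (proj₁ xψ) (proj₂ xψ))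
    (Unique.cartesianProduct⁺ (allVecs-unique k uniqueL) (HomTables-unique {L} uniqueM))

  ∈KernelPairs⁺ : ∀ {k L M} {x : Vec CG k} {ψ} → VAll.All (_∈ L) x → ψ ∈ HomTables L M → Kills L x ψ →
    (x , ψ) ∈ KernelPairs k L M
  ∈KernelPairs⁺ {L = L} x∈L ψ∈ kills = ∈-filter⁺ (λ xψ → kills? L (proj₁ xψ) (proj₂ xψ))
    (∈-cartesianProduct⁺ (∈-allVecs⁺ x∈L) ψ∈) kills

  ∈KernelPairs⁻ : ∀ {k L M} {x : Vec CG k} {ψ} → (x , ψ) ∈ KernelPairs k L M →
    VAll.All (_∈ L) x × ψ ∈ HomTables L M × Kills L x ψ
  ∈KernelPairs⁻ {k} {L} {M} xψ∈
    with xψ∈× , kills ← ∈-filter⁻ (λ xψ → kills? L (proj₁ xψ) (proj₂ xψ))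
                            {xs = cartesianProduct (allVecs k L) (HomTables L M)} xψ∈
    with x∈ , ψ∈ ← ∈-cartesianProduct⁻ (allVecs k L) (HomTables L M) xψ∈×
    = ∈-allVecs⁻ x∈ , ψ∈ , kills

  IsOnto : (L : List CG) (M : List CH) {k : ℕ} → Vec CG k → Set
  IsOnto L M x = ∀ {y} → VAll.All (_∈ M) y → ∃ λ ψ → ψ ∈ HomTables L M × Γ L x ψ ≡ y

  isOnto? : (L : List CG) (M : List CH) {k : ℕ} (x : Vec CG k) → Dec _
  isOnto? L M {k} x = LAll.all? (λ y → LAny.any? (λ ψ → Vec.≡-dec _≟H_ (Γ L x ψ) y) (HomTables L M)) (allVecs k M)

  OntoVecs : (k : ℕ) → List CG → List CH → List (Vec CG k)
  OntoVecs k L M = filter (isOnto? L M {k}) (allVecs k L)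

  ontoCount : ℕ → List CG → List CH → ℕ
  ontoCount k L M = length (OntoVecs k L M)

  OntoVecs-unique : ∀ k {L M} → Unique L → Unique (OntoVecs k L M)
  OntoVecs-unique k {L} {M} unique = Unique.filter⁺ (isOnto? L M {k}) (allVecs-unique k unique)

  ∈OntoVecs⁺ : ∀ {k L M} {x : Vec CG k} → VAll.All (_∈ L) x → IsOnto L M x → x ∈ OntoVecs k L M
  ∈OntoVecs⁺ {k} {L} {M} x∈L onto = ∈-filter⁺ (isOnto? L M {k}) (∈-allVecs⁺ x∈L)
    (LAll.tabulate λ y∈Mᵏ → let ψ , ψ∈ , Γψ≡y = onto (∈-allVecs⁻ y∈Mᵏ) in lose ψ∈ Γψ≡y)

  ∈OntoVecs⁻ : ∀ {k L M} {x : Vec CG k} → x ∈ OntoVecs k L M → VAll.All (_∈ L) x × IsOnto L M x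
  ∈OntoVecs⁻ {k} {L} {M} x∈ with x∈Lᵏ , onto ← ∈-filter⁻ (isOnto? L M {k}) {xs = allVecs k L} x∈ =
    ∈-allVecs⁻ x∈Lᵏ , λ y∈Mᵏ → find (LAll.lookup onto (∈-allVecs⁺ y∈Mᵏ))

  module Multiplicative {L L₁ L₂ : List CG} {M M₁ M₂ : List CH}
    (DG : DirectSum G L L₁ L₂) (DH : DirectSum H M M₁ M₂)
    (respects₁ : ∀ {f} → IsHomOn L M f → ∀ {x} → x ∈ L₁ → f x ∈ M₁)
    (respects₂ : ∀ {f} → IsHomOn L M f → ∀ {x} → x ∈ L₂ → f x ∈ M₂) where

    module g = DirectSum DG
    module h = DirectSum DH

    hom-π₁+π₂ : ∀ {f} → IsHomOn L M f → ∀ {x} → x ∈ L → f (g.π₁ x) +H f (g.π₂ x) ≡ f x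
    hom-π₁+π₂ {f} f-hom x∈L = trans (sym (homo f-hom (g.⊆₁ (g.π₁∈ x∈L)) (g.⊆₂ (g.π₂∈ x∈L)))) (cong f (g.π₁+π₂ x∈L))

    hom-π₁ : ∀ {f} → IsHomOn L M f → ∀ {x} → x ∈ L → f (g.π₁ x) ≡ h.π₁ (f x)
    hom-π₁ f-hom x∈L = trans (sym (h.π₁-+ (respects₁ f-hom (g.π₁∈ x∈L)) (respects₂ f-hom (g.π₂∈ x∈L))))
      (cong h.π₁ (hom-π₁+π₂ f-hom x∈L))

    hom-π₂ : ∀ {f} → IsHomOn L M f → ∀ {x} → x ∈ L → f (g.π₂ x) ≡ h.π₂ (f x)
    hom-π₂ f-hom x∈L = trans (sym (h.π₂-+ (respects₁ f-hom (g.π₁∈ x∈L)) (respects₂ f-hom (g.π₂∈ x∈L))))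
      (cong h.π₂ (hom-π₁+π₂ f-hom x∈L))

    restrict₁ : Tab L → Tab L₁
    restrict₁ ψ = table L₁ (ev L ψ)

    restrict₂ : Tab L → Tab L₂
    restrict₂ ψ = table L₂ (ev L ψ)

    restrict₁-hom : ∀ {ψ} → ψ ∈ HomTables L M → restrict₁ ψ ∈ HomTables L₁ M₁
    restrict₁-hom ψ∈ = table∈HomTables g.closed₁ record
      { into = respects₁ (∈HomTables⁻ ψ∈) ; homo = λ x∈ y∈ → homo (∈HomTables⁻ ψ∈) (g.⊆₁ x∈) (g.⊆₁ y∈) }

    restrict₂-hom : ∀ {ψ} → ψ ∈ HomTables L M → restrict₂ ψ ∈ HomTables L₂ M₂
    restrict₂-hom ψ∈ = table∈HomTables g.closed₂ record
      { into = respects₂ (∈HomTables⁻ ψ∈) ; homo = λ x∈ y∈ → homo (∈HomTables⁻ ψ∈) (g.⊆₂ x∈) (g.⊆₂ y∈) }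

    eval-restrict₁ : ∀ {ψ} → ψ ∈ HomTables L M → ∀ {x} → x ∈ L → ev L₁ (restrict₁ ψ) (g.π₁ x) ≡ h.π₁ (ev L ψ x)
    eval-restrict₁ {ψ} ψ∈ x∈L = trans (eval-table L₁ (ev L ψ) (g.π₁∈ x∈L)) (hom-π₁ (∈HomTables⁻ ψ∈) x∈L)

    eval-restrict₂ : ∀ {ψ} → ψ ∈ HomTables L M → ∀ {x} → x ∈ L → ev L₂ (restrict₂ ψ) (g.π₂ x) ≡ h.π₂ (ev L ψ x)
    eval-restrict₂ {ψ} ψ∈ x∈L = trans (eval-table L₂ (ev L ψ) (g.π₂∈ x∈L)) (hom-π₂ (∈HomTables⁻ ψ∈) x∈L)

    glue : Tab L₁ → Tab L₂ → CG → CH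
    glue ψ₁ ψ₂ x = ev L₁ ψ₁ (g.π₁ x) +H ev L₂ ψ₂ (g.π₂ x)

    combine : Tab L₁ → Tab L₂ → Tab L
    combine ψ₁ ψ₂ = table L (glue ψ₁ ψ₂)

    module _ {ψ₁ ψ₂} (ψ₁∈ : ψ₁ ∈ HomTables L₁ M₁) (ψ₂∈ : ψ₂ ∈ HomTables L₂ M₂) where

      private
        ψ₁-hom : IsHomOn L₁ M₁ (ev L₁ ψ₁)
        ψ₁-hom = ∈HomTables⁻ ψ₁∈
        ψ₂-hom : IsHomOn L₂ M₂ (ev L₂ ψ₂)
        ψ₂-hom = ∈HomTables⁻ ψ₂∈

      combine-hom : combine ψ₁ ψ₂ ∈ HomTables L M
      combine-hom = table∈HomTables g.closed record
        { into = λ x∈L → h.+∈ (into ψ₁-hom (g.π₁∈ x∈L)) (into ψ₂-hom (g.π₂∈ x∈L))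
        ; homo = λ {x} {y} x∈L y∈L → trans
            (cong₂ _+H_ (trans (cong (ev L₁ ψ₁) (g.π₁-homo x∈L y∈L)) (homo ψ₁-hom (g.π₁∈ x∈L) (g.π₁∈ y∈L)))
                        (trans (cong (ev L₂ ψ₂) (g.π₂-homo x∈L y∈L)) (homo ψ₂-hom (g.π₂∈ x∈L) (g.π₂∈ y∈L))))
            (MH.interchange _ _ _ _)
        }

      eval-combine-+ : ∀ {x₁ x₂} → x₁ ∈ L₁ → x₂ ∈ L₂ →
        ev L (combine ψ₁ ψ₂) (x₁ +G x₂) ≡ ev L₁ ψ₁ x₁ +H ev L₂ ψ₂ x₂
      eval-combine-+ x₁∈ x₂∈ = trans (eval-table L (glue ψ₁ ψ₂) (g.+∈ x₁∈ x₂∈))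
        (cong₂ _+H_ (cong (ev L₁ ψ₁) (g.π₁-+ x₁∈ x₂∈)) (cong (ev L₂ ψ₂) (g.π₂-+ x₁∈ x₂∈)))

      restrict₁-combine : restrict₁ (combine ψ₁ ψ₂) ≡ ψ₁
      restrict₁-combine = table-ext g.unique₁ λ {x} x∈L₁ → begin
        ev L₁ (restrict₁ (combine ψ₁ ψ₂)) x ≡⟨ eval-table L₁ _ x∈L₁ ⟩
        ev L (combine ψ₁ ψ₂) x              ≡⟨ cong (ev L (combine ψ₁ ψ₂)) (MG.identityʳ x) ⟨
        ev L (combine ψ₁ ψ₂) (x +G 0G)      ≡⟨ eval-combine-+ x∈L₁ g.0∈₂ ⟩
        ev L₁ ψ₁ x +H ev L₂ ψ₂ 0G           ≡⟨ cong (ev L₁ ψ₁ x +H_) (0↦0 ψ₂-hom g.0∈₂) ⟩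
        ev L₁ ψ₁ x +H 0H                    ≡⟨ MH.identityʳ _ ⟩
        ev L₁ ψ₁ x                          ∎
        where open ≡-Reasoning

      restrict₂-combine : restrict₂ (combine ψ₁ ψ₂) ≡ ψ₂
      restrict₂-combine = table-ext g.unique₂ λ {x} x∈L₂ → begin
        ev L₂ (restrict₂ (combine ψ₁ ψ₂)) x ≡⟨ eval-table L₂ _ x∈L₂ ⟩
        ev L (combine ψ₁ ψ₂) x              ≡⟨ cong (ev L (combine ψ₁ ψ₂)) (MG.identityˡ x) ⟨
        ev L (combine ψ₁ ψ₂) (0G +G x)      ≡⟨ eval-combine-+ g.0∈₁ x∈L₂ ⟩
        ev L₁ ψ₁ 0G +H ev L₂ ψ₂ x           ≡⟨ cong (_+H ev L₂ ψ₂ x) (0↦0 ψ₁-hom g.0∈₁) ⟩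
        0H +H ev L₂ ψ₂ x                    ≡⟨ MH.identityˡ _ ⟩
        ev L₂ ψ₂ x                          ∎
        where open ≡-Reasoning

      Γ-combine-join : ∀ {k} {x₁ x₂ : Vec CG k} → VAll.All (_∈ L₁) x₁ → VAll.All (_∈ L₂) x₂ →
        Γ L (Vec.zipWith _+G_ x₁ x₂) (combine ψ₁ ψ₂) ≡ Vec.zipWith _+H_ (Γ L₁ x₁ ψ₁) (Γ L₂ x₂ ψ₂)
      Γ-combine-join = map-zipWith-on eval-combine-+

    combine-restrict : ∀ {ψ} → ψ ∈ HomTables L M → combine (restrict₁ ψ) (restrict₂ ψ) ≡ ψ
    combine-restrict {ψ} ψ∈ = table-ext g.unique λ x∈L →
      trans (eval-table L _ x∈L)
        (trans (cong₂ _+H_ (eval-restrict₁ ψ∈ x∈L) (eval-restrict₂ ψ∈ x∈L))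
          (h.π₁+π₂ (into (∈HomTables⁻ ψ∈) x∈L)))

    module _ (k : ℕ) where

      splitPair : Vec CG k × Tab L → (Vec CG k × Tab L₁) × (Vec CG k × Tab L₂)
      splitPair (x , ψ) = (Vec.map g.π₁ x , restrict₁ ψ) , (Vec.map g.π₂ x , restrict₂ ψ)

      splitPair-into : ∀ {xψ} → xψ ∈ KernelPairs k L M →
        proj₁ (splitPair xψ) ∈ KernelPairs k L₁ M₁ × proj₂ (splitPair xψ) ∈ KernelPairs k L₂ M₂
      splitPair-into xψ∈ with x∈Lᵏ , ψ∈ , kills ← ∈KernelPairs⁻ xψ∈ =
        ∈KernelPairs⁺ (VAllP.map⁺ (VAll.map g.π₁∈ x∈Lᵏ)) (restrict₁-hom ψ∈)
          (VAllP.map⁺ (VAll.map (λ (xᵢ∈L , ψxᵢ≡0) → trans (eval-restrict₁ ψ∈ xᵢ∈L)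
            (trans (cong h.π₁ ψxᵢ≡0) (h.π₁-on₁ h.0∈₁))) (VAll.zip (x∈Lᵏ , kills)))) ,
        ∈KernelPairs⁺ (VAllP.map⁺ (VAll.map g.π₂∈ x∈Lᵏ)) (restrict₂-hom ψ∈)
          (VAllP.map⁺ (VAll.map (λ (xᵢ∈L , ψxᵢ≡0) → trans (eval-restrict₂ ψ∈ xᵢ∈L)
            (trans (cong h.π₂ ψxᵢ≡0) (h.π₂-on₂ h.0∈₂))) (VAll.zip (x∈Lᵏ , kills))))

      splitPair-injective : ∀ {xψ xψ'} → xψ ∈ KernelPairs k L M → xψ' ∈ KernelPairs k L M →
        splitPair xψ ≡ splitPair xψ' → xψ ≡ xψ'
      splitPair-injective xψ∈ xψ'∈ same
        with x∈Lᵏ , ψ∈ , _ ← ∈KernelPairs⁻ xψ∈ | x'∈Lᵏ , ψ'∈ , _ ← ∈KernelPairs⁻ xψ'∈ =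
        cong₂ _,_ (g.split-injective x∈Lᵏ x'∈Lᵏ (cong (proj₁ ∘′ proj₁) same) (cong (proj₁ ∘′ proj₂) same))
          (trans (sym (combine-restrict ψ∈))
            (trans (cong₂ combine (cong (proj₂ ∘′ proj₁) same) (cong (proj₂ ∘′ proj₂) same)) (combine-restrict ψ'∈)))

      splitPair-onto : ∀ {xψ₁ xψ₂} → xψ₁ ∈ KernelPairs k L₁ M₁ → xψ₂ ∈ KernelPairs k L₂ M₂ →
        ∃ λ xψ → xψ ∈ KernelPairs k L M × splitPair xψ ≡ (xψ₁ , xψ₂)
      splitPair-onto {x₁ , ψ₁} {x₂ , ψ₂} xψ₁∈ xψ₂∈
        with x₁∈ , ψ₁∈ , kills₁ ← ∈KernelPairs⁻ xψ₁∈ | x₂∈ , ψ₂∈ , kills₂ ← ∈KernelPairs⁻ xψ₂∈ =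
        (Vec.zipWith _+G_ x₁ x₂ , combine ψ₁ ψ₂) ,
        ∈KernelPairs⁺ (VAll.zipWith g.+∈ x₁∈ x₂∈) (combine-hom ψ₁∈ ψ₂∈)
          (VAll.zipWith (λ (a∈ , ψ₁a≡0) (b∈ , ψ₂b≡0) → trans (eval-combine-+ ψ₁∈ ψ₂∈ a∈ b∈)
            (trans (cong₂ _+H_ ψ₁a≡0 ψ₂b≡0) (MH.identityʳ 0H))) (VAll.zip (x₁∈ , kills₁)) (VAll.zip (x₂∈ , kills₂))) ,
        cong₂ _,_ (cong₂ _,_ (g.map-π₁-join x₁∈ x₂∈) (restrict₁-combine ψ₁∈ ψ₂∈))
                  (cong₂ _,_ (g.map-π₂-join x₁∈ x₂∈) (restrict₂-combine ψ₁∈ ψ₂∈))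

      γᴸ-multiplicative : γᴸ k L M ≡ γᴸ k L₁ M₁ * γᴸ k L₂ M₂
      γᴸ-multiplicative = begin
        γᴸ k L M                                                  ≡⟨ γᴸ≡length-KernelPairs k L M ⟩
        length (KernelPairs k L M)                                ≡⟨ length-≡-*-via-bijection splitPair
          (KernelPairs-unique k g.unique h.unique) (KernelPairs-unique k g.unique₁ h.unique₁)
          (KernelPairs-unique k g.unique₂ h.unique₂) splitPair-injective splitPair-into splitPair-onto ⟩
        length (KernelPairs k L₁ M₁) * length (KernelPairs k L₂ M₂) ≡⟨ cong₂ _*_ (γᴸ≡length-KernelPairs k L₁ M₁)
                                                                        (γᴸ≡length-KernelPairs k L₂ M₂) ⟨
        γᴸ k L₁ M₁ * γᴸ k L₂ M₂                                   ∎
        where open ≡-Reasoning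

      onto-π₁ : ∀ {x : Vec CG k} → VAll.All (_∈ L) x → IsOnto L M x → IsOnto L₁ M₁ (Vec.map g.π₁ x)
      onto-π₁ {x} x∈Lᵏ onto {y₁} y₁∈M₁ᵏ with ψ , ψ∈ , Γxψ≡y₁ ← onto (VAll.map h.⊆₁ y₁∈M₁ᵏ) =
        restrict₁ ψ , restrict₁-hom ψ∈ , (begin
          Γ L₁ (Vec.map g.π₁ x) (restrict₁ ψ)              ≡⟨ Vec.map-∘ _ g.π₁ x ⟨
          Vec.map (λ xᵢ → ev L₁ (restrict₁ ψ) (g.π₁ xᵢ)) x ≡⟨ map-cong-on (eval-restrict₁ ψ∈) x∈Lᵏ ⟩
          Vec.map (λ xᵢ → h.π₁ (ev L ψ xᵢ)) x             ≡⟨ Vec.map-∘ h.π₁ (ev L ψ) x ⟩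
          Vec.map h.π₁ (Γ L x ψ)                           ≡⟨ cong (Vec.map h.π₁) Γxψ≡y₁ ⟩
          Vec.map h.π₁ y₁                                  ≡⟨ h.map-π₁-on₁ y₁∈M₁ᵏ ⟩
          y₁                                               ∎)
        where open ≡-Reasoning

      onto-π₂ : ∀ {x : Vec CG k} → VAll.All (_∈ L) x → IsOnto L M x → IsOnto L₂ M₂ (Vec.map g.π₂ x)
      onto-π₂ {x} x∈Lᵏ onto {y₂} y₂∈M₂ᵏ with ψ , ψ∈ , Γxψ≡y₂ ← onto (VAll.map h.⊆₂ y₂∈M₂ᵏ) =
        restrict₂ ψ , restrict₂-hom ψ∈ , (begin
          Γ L₂ (Vec.map g.π₂ x) (restrict₂ ψ)              ≡⟨ Vec.map-∘ _ g.π₂ x ⟨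
          Vec.map (λ xᵢ → ev L₂ (restrict₂ ψ) (g.π₂ xᵢ)) x ≡⟨ map-cong-on (eval-restrict₂ ψ∈) x∈Lᵏ ⟩
          Vec.map (λ xᵢ → h.π₂ (ev L ψ xᵢ)) x             ≡⟨ Vec.map-∘ h.π₂ (ev L ψ) x ⟩
          Vec.map h.π₂ (Γ L x ψ)                           ≡⟨ cong (Vec.map h.π₂) Γxψ≡y₂ ⟩
          Vec.map h.π₂ y₂                                  ≡⟨ h.map-π₂-on₂ y₂∈M₂ᵏ ⟩
          y₂                                               ∎)
        where open ≡-Reasoning

      onto-join : ∀ {x₁ x₂ : Vec CG k} → VAll.All (_∈ L₁) x₁ → VAll.All (_∈ L₂) x₂ →
        IsOnto L₁ M₁ x₁ → IsOnto L₂ M₂ x₂ → IsOnto L M (Vec.zipWith _+G_ x₁ x₂)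
      onto-join {x₁} {x₂} x₁∈ x₂∈ onto₁ onto₂ {y} y∈Mᵏ
        with ψ₁ , ψ₁∈ , Γx₁ψ₁≡ ← onto₁ (VAllP.map⁺ (VAll.map h.π₁∈ y∈Mᵏ))
           | ψ₂ , ψ₂∈ , Γx₂ψ₂≡ ← onto₂ (VAllP.map⁺ (VAll.map h.π₂∈ y∈Mᵏ)) =
        combine ψ₁ ψ₂ , combine-hom ψ₁∈ ψ₂∈ , (begin
          Γ L (Vec.zipWith _+G_ x₁ x₂) (combine ψ₁ ψ₂)         ≡⟨ Γ-combine-join ψ₁∈ ψ₂∈ x₁∈ x₂∈ ⟩
          Vec.zipWith _+H_ (Γ L₁ x₁ ψ₁) (Γ L₂ x₂ ψ₂)           ≡⟨ cong₂ (Vec.zipWith _+H_) Γx₁ψ₁≡ Γx₂ψ₂≡ ⟩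
          Vec.zipWith _+H_ (Vec.map h.π₁ y) (Vec.map h.π₂ y)   ≡⟨ h.join-split y∈Mᵏ ⟩
          y                                                    ∎)
        where open ≡-Reasoning

      ontoCount-multiplicative : ontoCount k L M ≡ ontoCount k L₁ M₁ * ontoCount k L₂ M₂
      ontoCount-multiplicative = length-≡-*-via-bijection (λ x → Vec.map g.π₁ x , Vec.map g.π₂ x)
        (OntoVecs-unique k g.unique) (OntoVecs-unique k g.unique₁) (OntoVecs-unique k g.unique₂)
        (λ x∈ x'∈ same → g.split-injective (proj₁ (∈OntoVecs⁻ x∈)) (proj₁ (∈OntoVecs⁻ x'∈))
                           (cong proj₁ same) (cong proj₂ same))
        (λ x∈ → let x∈Lᵏ , onto = ∈OntoVecs⁻ x∈ in
          ∈OntoVecs⁺ (VAllP.map⁺ (VAll.map g.π₁∈ x∈Lᵏ)) (onto-π₁ x∈Lᵏ onto) ,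
          ∈OntoVecs⁺ (VAllP.map⁺ (VAll.map g.π₂∈ x∈Lᵏ)) (onto-π₂ x∈Lᵏ onto))
        (λ x₁∈ x₂∈ → let x₁∈L₁ᵏ , onto₁ = ∈OntoVecs⁻ x₁∈ ; x₂∈L₂ᵏ , onto₂ = ∈OntoVecs⁻ x₂∈ in
          _ , ∈OntoVecs⁺ (VAll.zipWith g.+∈ x₁∈L₁ᵏ x₂∈L₂ᵏ) (onto-join x₁∈L₁ᵏ x₂∈L₂ᵏ onto₁ onto₂) ,
          cong₂ _,_ (g.map-π₁-join x₁∈L₁ᵏ x₂∈L₂ᵏ) (g.map-π₂-join x₁∈L₁ᵏ x₂∈L₂ᵏ))

  module Trivial {L M} (uniqueL : Unique L) (uniqueM : Unique M) (0∈L : 0G ∈ L) (0∈M : 0H ∈ M)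
    (L-trivial : ∀ {x} → x ∈ L → x ≡ 0G) (M-trivial : ∀ {y} → y ∈ M → y ≡ 0H) where

    length-trivial : length L ≡ 1
    length-trivial = length≡1 0G uniqueL 0∈L L-trivial

    ψ₀ : Tab L
    ψ₀ = table L (λ _ → 0H)

    ψ₀-hom : ψ₀ ∈ HomTables L M
    ψ₀-hom = table∈HomTables
      (λ x∈L y∈L → subst (_∈ L) (sym (trans (cong₂ _+G_ (L-trivial x∈L) (L-trivial y∈L)) (MG.identityʳ 0G))) 0∈L)
      record { into = λ _ → 0∈M ; homo = λ _ _ → sym (MH.identityʳ 0H) }

    HomTables-trivial : ∀ {ψ} → ψ ∈ HomTables L M → ψ ≡ ψ₀
    HomTables-trivial ψ∈ = table-ext uniqueL λ x∈L →
      trans (M-trivial (into (∈HomTables⁻ ψ∈) x∈L)) (sym (eval-table L (λ _ → 0H) x∈L))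

    trivial-vec : ∀ {k} {x : Vec CG k} → VAll.All (_∈ L) x → x ≡ Vec.replicate k 0G
    trivial-vec x∈Lᵏ = All-≡⇒replicate (VAll.map L-trivial x∈Lᵏ)

    γᴸ-trivial : ∀ k → γᴸ k L M ≡ 1
    γᴸ-trivial k = trans (γᴸ≡length-KernelPairs k L M)
      (length≡1 (Vec.replicate k 0G , ψ₀) (KernelPairs-unique k uniqueL uniqueM)
        (∈KernelPairs⁺ (All-replicate k 0∈L) ψ₀-hom (All-replicate k (eval-table L (λ _ → 0H) 0∈L)))
        (λ xψ∈ → let x∈Lᵏ , ψ∈ , _ = ∈KernelPairs⁻ xψ∈ in cong₂ _,_ (trivial-vec x∈Lᵏ) (HomTables-trivial ψ∈)))

    ontoCount-trivial : ∀ k → ontoCount k L M ≡ 1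
    ontoCount-trivial k = length≡1 (Vec.replicate k 0G) (OntoVecs-unique k uniqueL)
      (∈OntoVecs⁺ (All-replicate k 0∈L) λ y∈Mᵏ → ψ₀ , ψ₀-hom ,
        trans (Vec.map-replicate (ev L ψ₀) 0G k)
          (trans (cong (Vec.replicate k) (eval-table L (λ _ → 0H) 0∈L))
            (sym (All-≡⇒replicate (VAll.map M-trivial y∈Mᵏ)))))
      (λ x∈ → trivial-vec (proj₁ (∈OntoVecs⁻ x∈)))

private
  toℚᵘ-/ : ∀ a b → toℚᵘ ((ℤ.+ a) / suc b) ℚᵘ.≃ ℚᵘ.mkℚᵘ (ℤ.+ a) b
  toℚᵘ-/ a b = toℚᵘ-fromℚᵘ (ℚᵘ.mkℚᵘ (ℤ.+ a) b)

/-*-/ : ∀ a b c d .{{_ : NonZero b}} .{{_ : NonZero d}} →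
  ((ℤ.+ a) / b) ℚ.* ((ℤ.+ c) / d) ≡ ((ℤ.+ (a * c)) / (b * d)) {{ℕ.m*n≢0 b d}}
/-*-/ a (suc b) c (suc d) = toℚᵘ-injective (ℚᵘ.≃-trans (toℚᵘ-homo-* ((ℤ.+ a) / suc b) ((ℤ.+ c) / suc d))
  (ℚᵘ.≃-trans (ℚᵘ.*-cong (toℚᵘ-/ a b) (toℚᵘ-/ c d))
    (ℚᵘ.≃-trans (ℚᵘ.*≡* (cong (ℤ._* (ℤ.+ (suc b * suc d))) (sym (ℤ.pos-* a c))))
      (ℚᵘ.≃-sym (toℚᵘ-/ (a * c) (ℕ.pred (suc b * suc d)))))))

1-/ : ∀ o n s .{{_ : NonZero s}} → o ℕ.+ n ≡ s → 1ℚ - (ℤ.+ n) / s ≡ (ℤ.+ o) / s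
1-/ o n (suc s) o+n≡s = toℚᵘ-injective (ℚᵘ.≃-trans (toℚᵘ-homo-+ 1ℚ (ℚ.- ((ℤ.+ n) / suc s)))
  (ℚᵘ.≃-trans (ℚᵘ.+-cong (ℚᵘ.≃-refl {toℚᵘ 1ℚ}) (ℚᵘ.≃-trans (toℚᵘ-homo‿- ((ℤ.+ n) / suc s)) (ℚᵘ.-‿cong (toℚᵘ-/ n s))))
    (ℚᵘ.≃-trans (ℚᵘ.*≡* cross-multiplied) (ℚᵘ.≃-sym (toℚᵘ-/ o s)))))
  where
  open ℤSolver.+-*-Solver
  o+n≡1+s : (ℤ.+ o) ℤ.+ (ℤ.+ n) ≡ ℤ.+ suc s
  o+n≡1+s = trans (sym (ℤ.pos-+ o n)) (cong ℤ.+_ o+n≡s)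
  cross-multiplied : ((ℤ.+ 1) ℤ.* (ℤ.+ suc s) ℤ.+ (ℤ.- (ℤ.+ n)) ℤ.* (ℤ.+ 1)) ℤ.* (ℤ.+ suc s) ≡ (ℤ.+ o) ℤ.* (ℤ.+ suc (s ℕ.+ 0))
  cross-multiplied = trans (cong (λ z → ((ℤ.+ 1) ℤ.* z ℤ.+ (ℤ.- (ℤ.+ n)) ℤ.* (ℤ.+ 1)) ℤ.* z) (sym o+n≡1+s))
    (trans (solve 2 (λ O N → (con (ℤ.+ 1) :* (O :+ N) :+ (:- N) :* con (ℤ.+ 1)) :* (O :+ N) := O :* (O :+ N)) refl (ℤ.+ o) (ℤ.+ n))
      (cong ((ℤ.+ o) ℤ.*_) (trans o+n≡1+s (cong (λ z → ℤ.+ suc z) (sym (ℕ.+-identityʳ s))))))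

product≢0 : (s : ℕ → ℕ) → (∀ p → NonZero (s p)) → ∀ Q → NonZero (product (map s Q))
product≢0 s s≢0 []      = _
product≢0 s s≢0 (q ∷ Q) = ℕ.m*n≢0 (s q) (product (map s Q)) {{s≢0 q}} {{product≢0 s s≢0 Q}}

productℚ-/ : ∀ (o s : ℕ → ℕ) (s≢0 : ∀ p → NonZero (s p)) Q →
  productℚ (map (λ p → ((ℤ.+ o p) / s p) {{s≢0 p}}) Q)
    ≡ ((ℤ.+ product (map o Q)) / product (map s Q)) {{product≢0 s s≢0 Q}}
productℚ-/ o s s≢0 []      = refl
productℚ-/ o s s≢0 (q ∷ Q) = trans (cong (((ℤ.+ o q) / s q) {{s≢0 q}} ℚ.*_) (productℚ-/ o s s≢0 Q))
  (/-*-/ (o q) (s q) (product (map o Q)) (product (map s Q)) {{s≢0 q}} {{product≢0 s s≢0 Q}})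

-- Primary decomposition

module _ (K : FinAbGroup) where

  open FinAbGroup K
  open Multiples K

  order≥1 : 1 ≤ order
  order≥1 = ℕ.>-nonZero⁻¹ order {{nonZero-∈ (elems-complete 0g)}}

  ∈elemsOf⁺ : (S : Sub K) → ∀ {x} → Mem S x → x ∈ elemsOf S
  ∈elemsOf⁺ S {x} x∈S = ∈-filter⁺ (mem? S) (elems-complete x) x∈S

  ∈elemsOf⁻ : (S : Sub K) → ∀ {x} → x ∈ elemsOf S → Mem S x
  ∈elemsOf⁻ S x∈ = proj₂ (∈-filter⁻ (mem? S) {xs = elems} x∈)

  ∈elemsOf-whole : ∀ x → x ∈ elemsOf (whole K)
  ∈elemsOf-whole x = ∈elemsOf⁺ (whole K) x

  elemsOf-unique : (S : Sub K) → Unique (elemsOf S)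
  elemsOf-unique S = Unique.filter⁺ (mem? S) elems-unique

  torsion : ℕ → Sub K
  torsion n = record { Mem = n annihilates_ ; mem? = λ x → (n · x) ≟ 0g ; mem0 = annihilates-0 n }

  torsion-enumerates : ∀ n → EnumeratesTorsion K n (elemsOf (torsion n))
  torsion-enumerates n = record { annihilated = ∈elemsOf⁻ (torsion n) ; complete = ∈elemsOf⁺ (torsion n) }

  pComp-enumerates : ∀ {p E} → Prime p → order ≤ E → EnumeratesTorsion K (p ^ E) (elemsOf (pComp K p))
  pComp-enumerates {p} {E} p-prime order≤E = record
    { annihilated = λ x∈ → Orders.pMem⇒prime^-annihilated K order≤E (∈elemsOf⁻ (pComp K p) x∈)
    ; complete    = λ p^Ex≡0 → ∈elemsOf⁺ (pComp K p) (Orders.prime^-annihilated⇒pMem K p-prime E p^Ex≡0) }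

  whole-enumerates : ∀ {N E} → order ≤ N → order ≤ E → EnumeratesTorsion K (primorial N ^ E) (elemsOf (whole K))
  whole-enumerates order≤N order≤E = record
    { annihilated = λ {x} _ → Orders.primorial^-annihilates K order≤N order≤E x
    ; complete    = λ {x} _ → ∈elemsOf-whole x }

module Decomposition (G H : FinAbGroup) where

  open Tables G H
  open FinAbGroup G using () renaming (order to |G|)
  open FinAbGroup H using () renaming (order to |H|)

  -- Any E ≥ |G|, |H| works: p^E annihilates exactly the p-component of either group.
  E = |G| ℕ.+ |H|

  |G|≤E : |G| ≤ E
  |G|≤E = m≤m+n |G| |H|

  |H|≤E : |H| ≤ E
  |H|≤E = m≤n+m |H| |G|

  module _ (k : ℕ) where

    sizeAt γAt ontoAt : ℕ → ℕ
    sizeAt p = size (pComp G p)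
    γAt    p = γᴸ k (elemsOf (pComp G p)) (elemsOf (pComp H p))
    ontoAt p = ontoCount k (elemsOf (pComp G p)) (elemsOf (pComp H p))

    record Factorises (Q : List ℕ) (L : List (FinAbGroup.Carrier G)) (M : List (FinAbGroup.Carrier H)) : Set where
      field
        length≡    : length L ≡ product (map sizeAt Q)
        γᴸ≡        : γᴸ k L M ≡ product (map γAt Q)
        ontoCount≡ : ontoCount k L M ≡ product (map ontoAt Q)

    -- Induction on Q: the (∏Q)^E-torsion splits off the p-component for the first prime p of Q.
    factorises : ∀ Q → LAll.All Prime Q → Unique Q → ∀ {L M} → Unique L → Unique M →
      EnumeratesTorsion G (product Q ^ E) L → EnumeratesTorsion H (product Q ^ E) M → Factorises Q L M
    factorises [] _ _ {L} {M} uniqueL uniqueM L-tor M-tor =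
      record { length≡ = length-trivial ; γᴸ≡ = γᴸ-trivial k ; ontoCount≡ = ontoCount-trivial k }
      where
      L-tor₁ = subst (λ n → EnumeratesTorsion G n L) (^-zeroˡ E) L-tor
      M-tor₁ = subst (λ n → EnumeratesTorsion H n M) (^-zeroˡ E) M-tor
      open Trivial uniqueL uniqueM (EnumeratesTorsion.0∈ L-tor₁) (EnumeratesTorsion.0∈ M-tor₁)
        (1-torsion-trivial G L-tor₁) (1-torsion-trivial H M-tor₁)
    factorises (p ∷ Q) (p-prime LAll.∷ Q-prime) (p∉Q ∷ Q-unique) {L} {M} uniqueL uniqueM L-tor M-tor = record
      { length≡    = trans DG.length-directSum (cong (sizeAt p *_) (Factorises.length≡ ih))
      ; γᴸ≡        = trans (Mul.γᴸ-multiplicative k) (cong (γAt p *_) (Factorises.γᴸ≡ ih))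
      ; ontoCount≡ = trans (Mul.ontoCount-multiplicative k) (cong (ontoAt p *_) (Factorises.ontoCount≡ ih))
      }
      where
      b = product Q ^ E
      p^E⊥b : Coprime (p ^ E) b
      p^E⊥b = coprime-^ (prime-coprime-product p-prime Q-prime (λ p∈Q → LAll.lookup p∉Q p∈Q refl)) E E
      pq^E≡ = ^-distribʳ-* p (product Q) E
      DG = torsionDirectSum G (bézoutSplit p^E⊥b) uniqueL (elemsOf-unique G (pComp G p)) (elemsOf-unique G (torsion G b))
             (subst (λ n → EnumeratesTorsion G n L) pq^E≡ L-tor) (pComp-enumerates G p-prime |G|≤E) (torsion-enumerates G b)
      DH = torsionDirectSum H (bézoutSplit p^E⊥b) uniqueM (elemsOf-unique H (pComp H p)) (elemsOf-unique H (torsion H b))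
             (subst (λ n → EnumeratesTorsion H n M) pq^E≡ M-tor) (pComp-enumerates H p-prime |H|≤E) (torsion-enumerates H b)
      module DG = DirectSum DG
      respects : ∀ {n L' M'} → (∀ {x} → x ∈ L' → x ∈ L) → EnumeratesTorsion G n L' → EnumeratesTorsion H n M' →
        ∀ {f} → IsHomOn L M f → ∀ {x} → x ∈ L' → f x ∈ M'
      respects L'⊆L L'-tor M'-tor f-hom = hom-preserves-torsion f-hom DG.closed (DG.⊆₁ DG.0∈₁) L'⊆L L'-tor M'-tor
      module Mul = Multiplicative DG DH
        (respects DG.⊆₁ (pComp-enumerates G p-prime |G|≤E) (pComp-enumerates H p-prime |H|≤E))
        (respects DG.⊆₂ (torsion-enumerates G b) (torsion-enumerates H b))
      ih = factorises Q Q-prime Q-unique (elemsOf-unique G (torsion G b)) (elemsOf-unique H (torsion H b))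
             (torsion-enumerates G b) (torsion-enumerates H b)

  N = |G| * |H|

  |G|≤N : |G| ≤ N
  |G|≤N = ≤-trans (≤-reflexive (sym (*-identityʳ |G|))) (*-monoʳ-≤ |G| (order≥1 H))

  |H|≤N : |H| ≤ N
  |H|≤N = ≤-trans (≤-reflexive (sym (*-identityˡ |H|))) (*-monoˡ-≤ |H| (order≥1 G))

  wholeFactorises : ∀ k → Factorises k (primesUpTo N) (elemsOf (whole G)) (elemsOf (whole H))
  wholeFactorises k = factorises k (primesUpTo N) (primesUpTo-prime N) (primesUpTo-unique N)
    (elemsOf-unique G (whole G)) (elemsOf-unique H (whole H))
    (whole-enumerates G |G|≤N |G|≤E) (whole-enumerates H |H|≤N |H|≤E)

module _ (G H : FinAbGroup) where

  open Tables G H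
  open Decomposition G H

  restriction-to-pComp : (φ : FinAbGroup.Carrier G → FinAbGroup.Carrier H) → IsHom G H φ →
    (p : ℕ) → Prime p →
    ∃ λ (ψ : Table {G} {H} (pComp G p)) → ψ ∈ Homs (pComp G p) (pComp H p)
      × ((x : FinAbGroup.Carrier G) → Mem (pComp G p) x → eval {G} {H} (pComp G p) ψ x ≡ φ x)
  restriction-to-pComp φ φ-hom p p-prime =
    table L₁ φ ,
    table∈HomTables (EnumeratesTorsion.closed L₁-tor) record
      { into = hom-preserves-torsion φ-homᴳ (λ _ _ → ∈elemsOf-whole G _) (∈elemsOf-whole G _)
                 (λ _ → ∈elemsOf-whole G _) L₁-tor (pComp-enumerates H p-prime |H|≤E)
      ; homo = λ _ _ → φ-hom _ _ } ,
    λ x x∈Gₚ → eval-table L₁ φ (∈elemsOf⁺ G (pComp G p) x∈Gₚ)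
    where
    L₁ = elemsOf (pComp G p)
    L₁-tor = pComp-enumerates G p-prime |G|≤E
    φ-homᴳ : IsHomOn (elemsOf (whole G)) (elemsOf (whole H)) φ
    φ-homᴳ = record { into = λ _ → ∈elemsOf-whole H _ ; homo = λ _ _ → φ-hom _ _ }

  γ-multiplicative : ∀ k → γ k (whole G) (whole H) ≡ product (map (λ p → γ k (pComp G p) (pComp H p)) (primesUpTo N))
  γ-multiplicative k = Factorises.γᴸ≡ (wholeFactorises k)

  size^k≢0 : ∀ (S : Sub G) k → NonZero (size S ^ k)
  size^k≢0 S k = m^n≢0 (size S) k {{|S|≢0 S}}

  1-η≡ontoCount/ : ∀ k (S : Sub G) (T : Sub H) →
    1ℚ - η k S T ≡ ((ℤ.+ ontoCount k (elemsOf S) (elemsOf T)) / (size S ^ k)) {{size^k≢0 S k}}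
  1-η≡ontoCount/ k S T = 1-/ (ontoCount k (elemsOf S) (elemsOf T)) (nonOntoCount {G} {H} k S T) (size S ^ k) {{size^k≢0 S k}}
    (trans (length-filter-+-length-filter-¬ (isOnto? (elemsOf S) (elemsOf T) {k}) (allVecs k (elemsOf S)))
           (length-allVecs k (elemsOf S)))

  η-multiplicative : ∀ k → 1ℚ - η k (whole G) (whole H)
    ≡ productℚ (map (λ p → 1ℚ - η k (pComp G p) (pComp H p)) (primesUpTo N))
  η-multiplicative k = begin
    1ℚ - η k (whole G) (whole H)
      ≡⟨ 1-η≡ontoCount/ k (whole G) (whole H) ⟩
    ((ℤ.+ ontoCount k (elemsOf (whole G)) (elemsOf (whole H))) / (size (whole G) ^ k)) {{size^k≢0 (whole G) k}}
      ≡⟨ /-cong {{size^k≢0 (whole G) k}} {{product≢0 (λ p → sizeAt k p ^ k) (λ p → size^k≢0 (pComp G p) k) P}}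
           (cong ℤ.+_ (Factorises.ontoCount≡ (wholeFactorises k)))
           (trans (cong (_^ k) (Factorises.length≡ (wholeFactorises k))) (product-map-^ (sizeAt k) k P)) ⟩
    ((ℤ.+ product (map (ontoAt k) P)) / product (map (λ p → sizeAt k p ^ k) P))
       {{product≢0 (λ p → sizeAt k p ^ k) (λ p → size^k≢0 (pComp G p) k) P}}
      ≡⟨ productℚ-/ (ontoAt k) (λ p → sizeAt k p ^ k) (λ p → size^k≢0 (pComp G p) k) P ⟨
    productℚ (map (λ p → ((ℤ.+ ontoAt k p) / (sizeAt k p ^ k)) {{size^k≢0 (pComp G p) k}}) P)
      ≡⟨ cong productℚ (map-cong (λ p → sym (1-η≡ontoCount/ k (pComp G p) (pComp H p))) P) ⟩
    productℚ (map (λ p → 1ℚ - η k (pComp G p) (pComp H p)) P) ∎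
    where
    open ≡-Reasoning
    P = primesUpTo N

lemma3p6 : (G H : FinAbGroup) (k : ℕ) → 1 ≤ k →
    ((φ : FinAbGroup.Carrier G → FinAbGroup.Carrier H) → IsHom G H φ →
       (p : ℕ) → Prime p →
       ∃ λ (ψ : Table {G} {H} (pComp G p)) →
         ψ ∈ Homs (pComp G p) (pComp H p)
         × ((x : FinAbGroup.Carrier G) → Mem (pComp G p) x → eval {G} {H} (pComp G p) ψ x ≡ φ x))
    × (γ k (whole G) (whole H)
         ≡ product (map (λ p → γ k (pComp G p) (pComp H p))
                        (primesUpTo (FinAbGroup.order G * FinAbGroup.order H))))
    × (1ℚ - η k (whole G) (whole H)
         ≡ productℚ (map (λ p → 1ℚ - η k (pComp G p) (pComp H p))
                         (primesUpTo (FinAbGroup.order G * FinAbGroup.order H))))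
lemma3p6 G H k _ = restriction-to-pComp G H , γ-multiplicative G H k , η-multiplicative G H k
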